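{- Let $C,D$ be XOR-clauses, $I:=C\cap D$, and assume $\mathrm{var}(C)\cap\mathrm{var}(D)=\mathrm{var}(I)$, $|I|\ge2$, $|C|>|I|$ and $|D|>|I|$. Choose a variable $s\notin\mathrm{var}(C)\cup\mathrm{var}(D)$, and let $I':=I\cup\{s\}$, $C':=(C\setminus I)\cup\{s\}$, $D':=(D\setminus I)\cup\{s\}$. Then the XOR-clause-set $\{I',C',D'\}$ represents the XOR-clause-set $\{C,D\}$, and $X_2(C,D):=X_1(\{I',C',D'\})$ is an absolute forcing representation of the XOR-clause-set $\{C,D\}$.
   Context: Clauses are finite sets of literals without complementary pairs, clause-sets finite sets of clauses read as CNF ($\top$ empty clause-set, $\bot$ empty clause); $\varphi*F$ applies a partial assignment. A literal $x$ is forced for $F$ if $\langle x\to0\rangle*F$ is unsatisfiable; $r_1$ is unit-clause propagation. An XOR-clause $C$ denotes $\bigoplus_{x\in C}x=0$ over $\mathbb{Z}_2$ (with $\overline v$ valued $1\oplus v$); an XOR-clause-set is a conjunction. An XOR-clause-set $F'$ represents an XOR-clause-set $F$ if the satisfying total assignments of $F'$ projected to $\mathrm{var}(F)$ are precisely those of $F$. $X_0(C)$: all clauses $E$ with $\mathrm{var}(E)=\mathrm{var}(C)$ whose number of complemented literals has parity different from that in $C$. Natural splitting of $C=\{x_1,\dots,x_n\}$ (in some order): $\{C\}$ if $n\le2$, else XOR-clauses $\{x_1,x_2,y_2\}$, $\{y_{i-1},x_i,y_i\}$ ($3\le i\le n-1$), $\{y_{n-1},x_n\}$ with new variables; $X_1(C)$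 is $X_0$ applied clausewise to it, $X_1(F)=\bigcup_{C\in F}X_1(C)$ with disjoint new variables. A CNF-representation of XOR-clause-set $F$ is a clause-set $F'$ with $\mathrm{var}(F)\subseteq\mathrm{var}(F')$ such that for each total assignment $\varphi$ of $\mathrm{var}(F)$, $\varphi*F'$ is satisfiable iff $\varphi$ satisfies $F$. It is absolute forcing if (i) for every partial assignment $\varphi$ (over any variables), either $\varphi*F'$ is unsatisfiable and $r_1(\varphi*F')=\{\bot\}$, or it is satisfiable and $r_1(\varphi*F')$ has no forced literals; and (ii) $r_1(\varphi*F')=\top$ for every total $\varphi$ of $\mathrm{var}(F)$ with $\varphi*F'$ satisfiable. -}

module Defs where

open import Data.Nat using (ℕ; zero; suc; _≟_)
open import Data.Bool using (Bool; true; false; not; if_then_else_; _xor_; T)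
open import Data.Bool.Properties using () renaming (_≟_ to _≟B_)
open import Data.Maybe using (Maybe; just; nothing)
open import Data.Product using (Σ; ∃; _×_; _,_; proj₁; proj₂)
open import Data.Product.Properties using (≡-dec)
open import Data.List using (List; []; _∷_; _++_; map; filter; concatMap; length; foldr)
open import Data.Bool.ListAction using (any)
open import Data.List.Relation.Unary.All using (All)
open import Data.List.Relation.Unary.Any using (Any)
open import Relation.Nullary using (¬_; Dec; yes; no)
open import Relation.Nullary.Decidable using (⌊_⌋; does; T?)
open import Relation.Binary.PropositionalEquality using (_≡_)
open import Relation.Binary.Definitions using (DecidableEquality)
open import Function.Bundles using (_⇔_)

-- Literals, clauses, clause-sets
--   A literal is a pair (v , b): variable v ∈ ℕ, b = true for the positive
--   literal v, b = false for the complemented literal v̄.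
--   Clauses (CNF- or XOR-) are lists of literals read as sets; for the
--   clauses of the theorem we require distinct variables (so no duplicates
--   and no complementary pairs).

Var : Set
Var = ℕ

Lit : Set
Lit = Var × Bool

var : Lit → Var
var = proj₁

pos : Var → Lit
pos v = v , true

_≟L_ : DecidableEquality Lit
_≟L_ = ≡-dec _≟_ _≟B_

open import Data.List.Membership.DecPropositional _≟L_ public
  using () renaming (_∈?_ to _∈L?_; _∈_ to _∈L_)
open import Data.List.Membership.Propositional using (_∈_)
open import Data.List.Membership.DecPropositional _≟_ using () renaming (_∈?_ to _∈ℕ?_)

Clause : Set
Clause = List Lit

ClauseSet : Set
ClauseSet = List Clause

XClause : Set
XClause = List Lit

XClauseSet : Set
XClauseSet = List XClause

vars : List Lit → List Var
vars = map var

varsS : List (List Lit) → List Var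
varsS = concatMap vars

-- Total assignments: ψ : ℕ → Bool.  Partial assignments: φ : ℕ → Maybe Bool
-- (variables with value nothing are unassigned).

litVal : (Var → Bool) → Lit → Bool
litVal ψ (v , true) = ψ v
litVal ψ (v , false) = not (ψ v)

SatClause : (Var → Bool) → Clause → Set
SatClause ψ C = Any (λ x → T (litVal ψ x)) C

SatCS : (Var → Bool) → ClauseSet → Set
SatCS ψ F = All (SatClause ψ) F

Satisfiable : ClauseSet → Set
Satisfiable F = ∃ λ ψ → SatCS ψ F

xorVal : (Var → Bool) → XClause → Bool
xorVal ψ C = foldr (λ x b → litVal ψ x xor b) false C

XSat : (Var → Bool) → XClause → Set
XSat ψ C = xorVal ψ C ≡ false

XSatS : (Var → Bool) → XClauseSet → Set
XSatS ψ F = All (XSat ψ) F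

litPVal : (Var → Maybe Bool) → Lit → Maybe Bool
litPVal φ (v , b) with φ v
... | nothing = nothing
... | just c = just (if b then c else not c)

isTrue : Maybe Bool → Bool
isTrue (just true) = true
isTrue _ = false

isFalse : Maybe Bool → Bool
isFalse (just false) = true
isFalse _ = false

applyC : (Var → Maybe Bool) → Clause → Clause
applyC φ C = filter (λ x → T? (not (isFalse (litPVal φ x)))) C

satByφ : (Var → Maybe Bool) → Clause → Bool
satByφ φ C = any (λ x → isTrue (litPVal φ x)) C

_*_ : (Var → Maybe Bool) → ClauseSet → ClauseSet
φ * F = map (applyC φ) (filter (λ C → T? (not (satByφ φ C))) F)

single : Var → Bool → Var → Maybe Bool
single v b w with v ≟ w
... | yes _ = just b
... | no _ = nothing

setFalse : Lit → Var → Maybe Bool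
setFalse (v , b) = single v (not b)

setTrue : Lit → Var → Maybe Bool
setTrue (v , b) = single v b

restrict : List Var → (Var → Bool) → Var → Maybe Bool
restrict V ψ w with w ∈ℕ? V
... | yes _ = just (ψ w)
... | no _ = nothing

-- Unit-clause propagation r₁
--   r₁(F) = {⊥} if ⊥ ∈ F; r₁(⟨x→1⟩ * F) if {x} ∈ F; F otherwise.
--   ⊥ is the empty clause [], ⊤ the empty clause-set [].
--   Each unit step removes at least one clause, so |F| steps suffice.

hasEmpty : ClauseSet → Bool
hasEmpty [] = false
hasEmpty ([] ∷ F) = true
hasEmpty ((_ ∷ _) ∷ F) = hasEmpty F

findUnit : ClauseSet → Maybe Lit
findUnit [] = nothing
findUnit ((x ∷ []) ∷ F) = just x
findUnit (_ ∷ F) = findUnit F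

r1fuel : ℕ → ClauseSet → ClauseSet
r1fuel n F with hasEmpty F
... | true = [] ∷ []
r1fuel zero F | false = F
r1fuel (suc n) F | false with findUnit F
... | just x = r1fuel n (setTrue x * F)
... | nothing = F

r₁ : ClauseSet → ClauseSet
r₁ F = r1fuel (length F) F

-- x is forced for F iff ⟨x→0⟩ * F is unsatisfiable; "no forced literal":
NoForcedLits : ClauseSet → Set
NoForcedLits F = ∀ (x : Lit) → Satisfiable (setFalse x * F)

negCount : List Lit → ℕ
negCount [] = 0
negCount ((_ , true) ∷ C) = negCount C
negCount ((_ , false) ∷ C) = suc (negCount C)

allSignings : List Var → List Clause
allSignings [] = [] ∷ []
allSignings (v ∷ vs) =
  map ((v , true) ∷_) (allSignings vs) ++ map ((v , false) ∷_) (allSignings vs)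

parity : ℕ → Bool
parity zero = false
parity (suc n) = not (parity n)

X₀ : XClause → ClauseSet
X₀ C = filter (λ E → parity (negCount E) ≟B not (parity (negCount C)))
              (allSignings (vars C))

-- natural splitting of x₁,…,xₙ using the new variables y₂,…,y_{n-1}
-- (the list ys must have length n ∸ 2):
--   {C} if n ≤ 2, else {x₁,x₂,y₂}, {y_{i-1},xᵢ,yᵢ} (3 ≤ i ≤ n-1), {y_{n-1},xₙ}
splitChain : Lit → List Lit → List Var → XClauseSet
splitChain p (x ∷ []) [] = (p ∷ x ∷ []) ∷ []
splitChain p (x ∷ xs) (y ∷ ys) = (p ∷ x ∷ pos y ∷ []) ∷ splitChain (pos y) xs ys
splitChain p _ _ = []

natSplit : XClause → List Var → XClauseSet
natSplit (x₁ ∷ x₂ ∷ x₃ ∷ xs) (y ∷ ys) = (x₁ ∷ x₂ ∷ pos y ∷ []) ∷ splitChain (pos y) (x₃ ∷ xs) ys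
natSplit C _ = C ∷ []

X₁C : XClause → List Var → ClauseSet
X₁C C ys = concatMap X₀ (natSplit C ys)

Represents : XClauseSet → XClauseSet → Set
Represents F' F = ∀ (ψ : Var → Bool) →
  XSatS ψ F ⇔ (∃ λ ψ' → (∀ v → v ∈ varsS F → ψ' v ≡ ψ v) × XSatS ψ' F')

CNFRep : XClauseSet → ClauseSet → Set
CNFRep F F' =
  (∀ v → v ∈ varsS F → v ∈ varsS F') ×
  (∀ (ψ : Var → Bool) → Satisfiable (restrict (varsS F) ψ * F') ⇔ XSatS ψ F)

AbsForcingRep : XClauseSet → ClauseSet → Set
AbsForcingRep F F' =
  CNFRep F F' ×
  (∀ (φ : Var → Maybe Bool) →
      (¬ Satisfiable (φ * F') → r₁ (φ * F') ≡ [] ∷ []) ×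
      (Satisfiable (φ * F') → NoForcedLits (r₁ (φ * F')))) ×
  (∀ (ψ : Var → Bool) → Satisfiable (restrict (varsS F) ψ * F') →
      r₁ (restrict (varsS F) ψ * F') ≡ [])

open import Relation.Nullary.Decidable using (¬?)

_∩L_ : List Lit → List Lit → List Lit
C ∩L D = filter (_∈L? D) C

_∖L_ : List Lit → List Lit → List Lit
C ∖L D = filter (λ x → ¬? (x ∈L? D)) C

-- a clause: a set of literals without complementary pairs, i.e. a list
-- whose variables are pairwise distinct
open import Data.List.Relation.Unary.Unique.Propositional using (Unique)

IsClause : List Lit → Set
IsClause C = Unique (vars C)

module Submission where

-- The representation holds because C = I ⊕ (C∖I) and D = I ⊕ (D∖I), so
-- s := ⊕I links the parts.  Absolute forcing follows from a general
-- criterion (module AbsoluteForcing): if an XOR-clause-set S represents F,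
-- its models are determined by their values on var(F), and S is
-- extendable (under any partial assignment settling all clauses of S, each
-- open variable can take either value in a model), then X₀(S) is an
-- absolute forcing representation of F.  The key facts behind it are that
-- unit propagation on ρ * X₀(S) either refutes or reaches a state in which
-- every clause of S is settled (X₀ is propagation-complete per clause).
-- X₂ is X₀(S) for S the natural splittings of I', C', D'.  Each splitting
-- is a chain of clauses linked by single variables, hence extendable, and
-- the three chains share only s, so S is extendable too.

open import Defs
open import Data.Nat using (zero; suc; _≤_; _<_; _+_; _∸_; z≤n; s≤s) renaming (_≟_ to _≟ℕ_)
open import Data.Nat.Properties using (≤-refl; ≤-pred; <-≤-trans; ≤-trans; <-irrefl; +-identityʳ; +-comm; suc-injective)
open import Data.Bool using (Bool; true; false; not; if_then_else_; _xor_; T; _∨_)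
open import Data.Bool.Properties using (xor-assoc; xor-comm; xor-same; xor-identityʳ; not-distribˡ-xor; not-distribʳ-xor; ∨-zeroʳ; ∨-conicalˡ; ∨-conicalʳ; T-≡) renaming (_≟_ to _≟B_)
open import Data.Maybe using (Maybe; just; nothing)
import Data.Maybe as Maybe
open import Data.Product using (∃; ∃₂; _×_; _,_; proj₁; proj₂)
open import Data.Sum using (_⊎_; inj₁; inj₂)
open import Data.Empty using (⊥; ⊥-elim)
open import Data.Unit using (tt)
open import Data.List using (List; []; _∷_; _++_; map; filter; concatMap; length)
open import Data.List.Properties using (length-map; filter-notAll; concatMap-++; length-++; map-++)
open import Data.List.Relation.Unary.All as All using (All; []; _∷_)
open import Data.List.Relation.Unary.All.Properties using (++⁺; ++⁻ˡ; ++⁻ʳ)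
open import Data.List.Relation.Unary.Any as Any using (Any; here; there)
open import Data.List.Relation.Unary.AllPairs using ([]; _∷_)
open import Data.List.Relation.Unary.Unique.Propositional using (Unique)
import Data.List.Relation.Unary.Unique.Propositional.Properties as Unique
open import Data.List.Membership.Propositional using (_∈_; _∉_)
open import Data.List.Membership.Propositional.Properties
open import Data.List.Membership.DecPropositional _≟ℕ_ using (_∈?_)
open import Data.List.Relation.Binary.Permutation.Propositional as ↭ using (_↭_; ↭-sym; ↭⇒↭ₛ)
open import Data.List.Relation.Binary.Permutation.Propositional.Properties using (∈-resp-↭; ↭-length) renaming (map⁺ to ↭-map⁺; shift to ↭-shift; ++⁺ʳ to ↭-++⁺ʳ)
import Data.List.Relation.Binary.Permutation.Setoid.Properties as ↭ₛ
open import Data.List.Membership.Propositional.Properties.WithK using (unique∧set⇒bag)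
open import Data.List.Relation.Binary.BagAndSetEquality using (∼bag⇒↭)
open import Relation.Nullary using (¬_; yes; no)
open import Relation.Nullary.Decidable using (⌊_⌋; does; T?; ¬?)
open import Relation.Unary using (Decidable)
open import Relation.Binary.PropositionalEquality
open import Function.Bundles using (_⇔_; mk⇔; Equivalence)

_⊒_ : (Var → Bool) → (Var → Maybe Bool) → Set
ψ ⊒ ρ = ∀ v c → ρ v ≡ just c → ψ v ≡ c

_⊑_ : (Var → Maybe Bool) → (Var → Maybe Bool) → Set
ρ ⊑ ρ' = ∀ v c → ρ v ≡ just c → ρ' v ≡ just c

⊑-trans : ∀ {ρ ρ' ρ''} → ρ ⊑ ρ' → ρ' ⊑ ρ'' → ρ ⊑ ρ''
⊑-trans p q v c e = q v c (p v c e)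

⊒-⊑ : ∀ {ψ ρ ρ'} → ρ ⊑ ρ' → ψ ⊒ ρ' → ψ ⊒ ρ
⊒-⊑ p h v c e = h v c (p v c e)

-- ρ ▹ σ: ρ, with the variables left open by ρ assigned by σ.  Applying
-- ρ and then σ to a clause-set is applying ρ ▹ σ (lemma apply-▹ below).
_▹_ : (Var → Maybe Bool) → (Var → Maybe Bool) → Var → Maybe Bool
(ρ ▹ σ) v = ρ v Maybe.<∣> σ v

⊑-▹ : ∀ ρ σ → ρ ⊑ (ρ ▹ σ)
⊑-▹ ρ σ v c e rewrite e = refl

⊒-▹ : ∀ {ψ ρ σ} → ψ ⊒ ρ → (∀ w c → ρ w ≡ nothing → σ w ≡ just c → ψ w ≡ c) → ψ ⊒ (ρ ▹ σ)
⊒-▹ {ρ = ρ} h₁ h₂ v c e with ρ v in eq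
⊒-▹ h₁ h₂ v c refl | just d = h₁ v d eq
... | nothing = h₂ v c eq e

fill : (Var → Maybe Bool) → (Var → Bool) → Var → Bool
fill ρ ψ v = Maybe.fromMaybe (ψ v) (ρ v)

fill-⊒ : ∀ ρ ψ → fill ρ ψ ⊒ ρ
fill-⊒ ρ ψ v c e rewrite e = refl

fill-open : ∀ ρ ψ v → ρ v ≡ nothing → fill ρ ψ v ≡ ψ v
fill-open ρ ψ v e rewrite e = refl

update : (Var → Bool) → Var → Bool → Var → Bool
update ψ u c v = if ⌊ v ≟ℕ u ⌋ then c else ψ v

update-here : ∀ ψ u c → update ψ u c u ≡ c
update-here ψ u c with u ≟ℕ u
... | yes _ = refl
... | no u≢u = ⊥-elim (u≢u refl)

update-elsewhere : ∀ ψ u c w → w ≢ u → update ψ u c w ≡ ψ w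
update-elsewhere ψ u c w w≢u with w ≟ℕ u
... | yes w≡u = ⊥-elim (w≢u w≡u)
... | no _ = refl

update-⊒ : ∀ {ψ ρ} u c → ψ ⊒ ρ → ρ u ≡ nothing → update ψ u c ⊒ ρ
update-⊒ {ψ} u c h open-u v d e with v ≟ℕ u
... | yes refl with () ← trans (sym open-u) e
... | no _ = h v d e

restrict-∈ : ∀ V ψ w → w ∈ V → restrict V ψ w ≡ just (ψ w)
restrict-∈ V ψ w m with w ∈? V
... | yes _ = refl
... | no w∉V = ⊥-elim (w∉V m)

restrict-⊒ : ∀ {ψ'} V ψ → (∀ w → w ∈ V → ψ' w ≡ ψ w) → ψ' ⊒ restrict V ψ
restrict-⊒ V ψ agree w c e with w ∈? V
restrict-⊒ V ψ agree w c refl | yes m = agree w m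

signed : Bool → Bool → Bool
signed b c = if b then c else not c

litVal-signed : ∀ ψ v b → litVal ψ (v , b) ≡ signed b (ψ v)
litVal-signed ψ v true = refl
litVal-signed ψ v false = refl

litPVal-signed : ∀ φ v b → litPVal φ (v , b) ≡ Maybe.map (signed b) (φ v)
litPVal-signed φ v b with φ v
... | nothing = refl
... | just c = refl

data LitView (ρ : Var → Maybe Bool) (v : Var) (b : Bool) : Set where
  open-lit : ρ v ≡ nothing → litPVal ρ (v , b) ≡ nothing → LitView ρ v b
  set-lit  : ∀ c → ρ v ≡ just c → litPVal ρ (v , b) ≡ just (signed b c) → LitView ρ v b

litView : ∀ ρ v b → LitView ρ v b
litView ρ v b with ρ v in e
... | nothing = open-lit e (trans (litPVal-signed ρ v b) (cong (Maybe.map (signed b)) e))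
... | just c = set-lit c e (trans (litPVal-signed ρ v b) (cong (Maybe.map (signed b)) e))

litVal-⊒ : ∀ {ψ ρ} → ψ ⊒ ρ → ∀ v b c → ρ v ≡ just c → litVal ψ (v , b) ≡ signed b c
litVal-⊒ {ψ} h v b c e = trans (litVal-signed ψ v b) (cong (signed b) (h v c e))

litVal-cong : ∀ {ψ ψ'} l → ψ (var l) ≡ ψ' (var l) → litVal ψ l ≡ litVal ψ' l
litVal-cong {ψ} {ψ'} (v , b) e =
  trans (litVal-signed ψ v b) (trans (cong (signed b) e) (sym (litVal-signed ψ' v b)))

signed-true : ∀ b c → signed b c ≡ true → c ≡ b
signed-true true c e = e
signed-true false false e = refl

signed-false : ∀ b c → signed b c ≡ false → b ≡ not c
signed-false true false e = refl
signed-false false true e = refl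

signed-self : ∀ b → signed b b ≡ true
signed-self true = refl
signed-self false = refl

signed-not : ∀ c → signed (not c) c ≡ false
signed-not true = refl
signed-not false = refl

isTrue-just : ∀ c → isTrue (just c) ≡ false → c ≡ false
isTrue-just false _ = refl

∨-false : ∀ a b → a ∨ b ≡ false → a ≡ false × b ≡ false
∨-false a b h = ∨-conicalˡ a b h , ∨-conicalʳ a b h

T⇒≡ : ∀ {b} → T b → b ≡ true
T⇒≡ = Equivalence.to T-≡

≡⇒T : ∀ {b} → b ≡ true → T b
≡⇒T = Equivalence.from T-≡

¬T⇒≡ : ∀ {b} → ¬ T b → b ≡ false
¬T⇒≡ {false} _ = refl
¬T⇒≡ {true} n = ⊥-elim (n tt)

filter-T : ∀ {A : Set} (p : A → Bool) x xs →
  filter (λ y → T? (p y)) (x ∷ xs) ≡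
    (if p x then x ∷ filter (λ y → T? (p y)) xs else filter (λ y → T? (p y)) xs)
filter-T p x xs with p x
... | true = refl
... | false = refl

apply-∷ : ∀ φ C F → φ * (C ∷ F) ≡ (if satByφ φ C then φ * F else applyC φ C ∷ φ * F)
apply-∷ φ C F rewrite filter-T (λ C → not (satByφ φ C)) C F with satByφ φ C
... | true = refl
... | false = refl

applyC-∷ : ∀ φ x C →
  applyC φ (x ∷ C) ≡ (if isFalse (litPVal φ x) then applyC φ C else x ∷ applyC φ C)
applyC-∷ φ x C rewrite filter-T (λ x → not (isFalse (litPVal φ x))) x C with isFalse (litPVal φ x)
... | true = refl
... | false = refl

applyC-∈ : ∀ φ F C → C ∈ F → satByφ φ C ≡ false → applyC φ C ∈ φ * F
applyC-∈ φ F C m e =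
  ∈-map⁺ (applyC φ) (∈-filter⁺ (λ C → T? (not (satByφ φ C))) m (subst (λ z → T (not z)) (sym e) tt))

literal-▹-open : ∀ ρ σ v b → ρ v ≡ nothing → litPVal (ρ ▹ σ) (v , b) ≡ litPVal σ (v , b)
literal-▹-open ρ σ v b e rewrite litPVal-signed (ρ ▹ σ) v b | litPVal-signed σ v b with ρ v
literal-▹-open ρ σ v b refl | nothing = refl

literal-▹-set : ∀ ρ σ v b c → ρ v ≡ just c → litPVal (ρ ▹ σ) (v , b) ≡ just (signed b c)
literal-▹-set ρ σ v b c e rewrite litPVal-signed (ρ ▹ σ) v b with ρ v
literal-▹-set ρ σ v b c refl | just .c = refl

satByφ-▹ : ∀ ρ σ C → satByφ ρ C ≡ true → satByφ (ρ ▹ σ) C ≡ true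
satByφ-▹ ρ σ ((v , b) ∷ C) h with litView ρ v b
... | open-lit e₁ e₂ rewrite e₂ =
  trans (cong (isTrue (litPVal (ρ ▹ σ) (v , b)) ∨_) (satByφ-▹ ρ σ C h)) (∨-zeroʳ _)
... | set-lit c e₁ e₂ rewrite literal-▹-set ρ σ v b c e₁ | e₂ with signed b c
...   | true = refl
...   | false = satByφ-▹ ρ σ C h

satByφ-applyC : ∀ ρ σ C → satByφ ρ C ≡ false → satByφ σ (applyC ρ C) ≡ satByφ (ρ ▹ σ) C
satByφ-applyC ρ σ [] h = refl
satByφ-applyC ρ σ ((v , b) ∷ C) h = step (∨-false _ _ h) (litView ρ v b)
  where
  step : isTrue (litPVal ρ (v , b)) ≡ false × satByφ ρ C ≡ false → LitView ρ v b →
    satByφ σ (applyC ρ ((v , b) ∷ C)) ≡ satByφ (ρ ▹ σ) ((v , b) ∷ C)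
  step (h₁ , h₂) (open-lit e₁ e₂) rewrite applyC-∷ ρ (v , b) C | e₂ | literal-▹-open ρ σ v b e₁ =
    cong (isTrue (litPVal σ (v , b)) ∨_) (satByφ-applyC ρ σ C h₂)
  step (h₁ , h₂) (set-lit c e₁ e₂) rewrite applyC-∷ ρ (v , b) C | e₂ | literal-▹-set ρ σ v b c e₁
    | isTrue-just (signed b c) h₁ = satByφ-applyC ρ σ C h₂

applyC-applyC : ∀ ρ σ C → satByφ ρ C ≡ false → applyC σ (applyC ρ C) ≡ applyC (ρ ▹ σ) C
applyC-applyC ρ σ [] h = refl
applyC-applyC ρ σ ((v , b) ∷ C) h = step (∨-false _ _ h) (litView ρ v b)
  where
  step : isTrue (litPVal ρ (v , b)) ≡ false × satByφ ρ C ≡ false → LitView ρ v b →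
    applyC σ (applyC ρ ((v , b) ∷ C)) ≡ applyC (ρ ▹ σ) ((v , b) ∷ C)
  step (h₁ , h₂) (open-lit e₁ e₂) rewrite applyC-∷ ρ (v , b) C | e₂ | applyC-∷ σ (v , b) (applyC ρ C)
    | applyC-∷ (ρ ▹ σ) (v , b) C | literal-▹-open ρ σ v b e₁ | applyC-applyC ρ σ C h₂ = refl
  step (h₁ , h₂) (set-lit c e₁ e₂) rewrite applyC-∷ ρ (v , b) C | e₂ | applyC-∷ (ρ ▹ σ) (v , b) C
    | literal-▹-set ρ σ v b c e₁ | isTrue-just (signed b c) h₁ = applyC-applyC ρ σ C h₂

apply-▹ : ∀ ρ σ F → σ * (ρ * F) ≡ (ρ ▹ σ) * F
apply-▹ ρ σ [] = refl
apply-▹ ρ σ (C ∷ F) rewrite apply-∷ ρ C F | apply-∷ (ρ ▹ σ) C F with satByφ ρ C in e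
... | true rewrite satByφ-▹ ρ σ C e = apply-▹ ρ σ F
... | false rewrite apply-∷ σ (applyC ρ C) (ρ * F) | satByφ-applyC ρ σ C e
      | applyC-applyC ρ σ C e | apply-▹ ρ σ F = refl

applyC-model : ∀ {ψ ρ} → ψ ⊒ ρ → ∀ C → satByφ ρ C ≡ false → SatClause ψ C → SatClause ψ (applyC ρ C)
applyC-model {ψ} {ρ} h ((v , b) ∷ C) e = step (∨-false _ _ e) (litView ρ v b)
  where
  step : isTrue (litPVal ρ (v , b)) ≡ false × satByφ ρ C ≡ false → LitView ρ v b →
    SatClause ψ ((v , b) ∷ C) → SatClause ψ (applyC ρ ((v , b) ∷ C))
  step (h₁ , h₂) (open-lit e₁ e₂) s rewrite applyC-∷ ρ (v , b) C | e₂ with s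
  ... | here p = here p
  ... | there q = there (applyC-model h C h₂ q)
  step (h₁ , h₂) (set-lit c e₁ e₂) s rewrite applyC-∷ ρ (v , b) C | e₂
    | isTrue-just (signed b c) h₁ with s
  ... | here p = ⊥-elim (subst T (trans (litVal-⊒ h v b c e₁) (isTrue-just (signed b c) h₁)) p)
  ... | there q = applyC-model h C h₂ q

apply-model : ∀ {ψ ρ} → ψ ⊒ ρ → ∀ F → SatCS ψ F → SatCS ψ (ρ * F)
apply-model h [] s = []
apply-model {ψ} {ρ} h (C ∷ F) (sC ∷ sF) rewrite apply-∷ ρ C F with satByφ ρ C in e
... | true = apply-model h F sF
... | false = applyC-model h C e sC ∷ apply-model h F sF

satByφ-model : ∀ {ψ ρ} → ψ ⊒ ρ → ∀ C → satByφ ρ C ≡ true → SatClause ψ C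
satByφ-model {ψ} {ρ} h ((v , b) ∷ C) e = step (litView ρ v b) e
  where
  step : LitView ρ v b → satByφ ρ ((v , b) ∷ C) ≡ true → SatClause ψ ((v , b) ∷ C)
  step (open-lit e₁ e₂) e' rewrite e₂ = there (satByφ-model h C e')
  step (set-lit c e₁ e₂) e' rewrite e₂ with signed b c in q
  ... | true = here (≡⇒T (trans (litVal-⊒ h v b c e₁) q))
  ... | false = there (satByφ-model h C e')

applyC-fill : ∀ {ψ} ρ C → SatClause ψ (applyC ρ C) → SatClause (fill ρ ψ) C
applyC-fill {ψ} ρ ((v , b) ∷ C) = step (litView ρ v b)
  where
  step : LitView ρ v b → SatClause ψ (applyC ρ ((v , b) ∷ C)) → SatClause (fill ρ ψ) ((v , b) ∷ C)
  step (open-lit e₁ e₂) s rewrite applyC-∷ ρ (v , b) C | e₂ with s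
  ... | here p = here (subst T (litVal-cong (v , b) (sym (fill-open ρ ψ v e₁))) p)
  ... | there q = there (applyC-fill ρ C q)
  step (set-lit c e₁ e₂) s rewrite applyC-∷ ρ (v , b) C | e₂ with signed b c in q
  ... | true = here (≡⇒T (trans (litVal-⊒ (fill-⊒ ρ ψ) v b c e₁) q))
  ... | false = there (applyC-fill ρ C s)

apply-fill : ∀ {ψ} ρ F → SatCS ψ (ρ * F) → SatCS (fill ρ ψ) F
apply-fill ρ [] s = []
apply-fill {ψ} ρ (C ∷ F) s rewrite apply-∷ ρ C F with satByφ ρ C in e | s
... | true | s' = satByφ-model (fill-⊒ ρ ψ) C e ∷ apply-fill ρ F s'
... | false | sC ∷ sF = applyC-fill ρ C sC ∷ apply-fill ρ F sF

satisfiable-apply⇒ : ∀ ρ F → Satisfiable (ρ * F) → ∃ λ ψ → ψ ⊒ ρ × SatCS ψ F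
satisfiable-apply⇒ ρ F (ψ , s) = fill ρ ψ , fill-⊒ ρ ψ , apply-fill ρ F s

satisfiable-apply⇐ : ∀ ρ F ψ → ψ ⊒ ρ → SatCS ψ F → Satisfiable (ρ * F)
satisfiable-apply⇐ ρ F ψ h s = ψ , apply-model h F s

Assigned : (Var → Maybe Bool) → Var → Set
Assigned ρ v = ∃ λ c → ρ v ≡ just c

assigned-satByφ : ∀ {ψ ρ} → ψ ⊒ ρ → ∀ C → (∀ x → x ∈ C → Assigned ρ (var x)) →
  SatClause ψ C → satByφ ρ C ≡ true
assigned-satByφ {ψ} {ρ} h ((v , b) ∷ C) a (here p) with a (v , b) (here refl)
... | c , e rewrite litPVal-signed ρ v b | e | sym (litVal-⊒ h v b c e) | T⇒≡ p = refl
assigned-satByφ {ψ} {ρ} h ((v , b) ∷ C) a (there q) =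
  trans (cong (isTrue (litPVal ρ (v , b)) ∨_) (assigned-satByφ h C (λ x m → a x (there m)) q)) (∨-zeroʳ _)

apply-total : ∀ {ψ ρ} → ψ ⊒ ρ → ∀ F → (∀ C → C ∈ F → ∀ x → x ∈ C → Assigned ρ (var x)) →
  SatCS ψ F → ρ * F ≡ []
apply-total h [] a s = refl
apply-total {ψ} {ρ} h (C ∷ F) a (sC ∷ sF) rewrite apply-∷ ρ C F | assigned-satByφ h C (a C (here refl)) sC =
  apply-total h F (λ C' m → a C' (there m)) sF

-- Unit-clause propagation

hasEmpty-true : ∀ G → hasEmpty G ≡ true → [] ∈ G
hasEmpty-true ([] ∷ G) e = here refl
hasEmpty-true ((_ ∷ _) ∷ G) e = there (hasEmpty-true G e)

hasEmpty-false : ∀ G → hasEmpty G ≡ false → [] ∉ G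
hasEmpty-false ((_ ∷ _) ∷ G) e (there m) = hasEmpty-false G e m

findUnit-just : ∀ G x → findUnit G ≡ just x → (x ∷ []) ∈ G
findUnit-just ((y ∷ []) ∷ G) x refl = here refl
findUnit-just ([] ∷ G) x e = there (findUnit-just G x e)
findUnit-just ((y ∷ z ∷ C) ∷ G) x e = there (findUnit-just G x e)

findUnit-nothing : ∀ G x → findUnit G ≡ nothing → (x ∷ []) ∉ G
findUnit-nothing ([] ∷ G) x e (there m) = findUnit-nothing G x e m
findUnit-nothing ((y ∷ z ∷ C) ∷ G) x e (there m) = findUnit-nothing G x e m

single-here : ∀ v b → single v b v ≡ just b
single-here v b with v ≟ℕ v
... | yes _ = refl
... | no v≢v = ⊥-elim (v≢v refl)

single-just : ∀ v b w c → single v b w ≡ just c → w ≡ v × c ≡ b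
single-just v b w c e with v ≟ℕ w
single-just v b w c refl | yes refl = refl , refl

setTrue-self : ∀ x → litPVal (setTrue x) x ≡ just true
setTrue-self (v , b) rewrite litPVal-signed (single v b) v b | single-here v b | signed-self b = refl

⊒-setTrue : ∀ {ψ} x → T (litVal ψ x) → ψ ⊒ setTrue x
⊒-setTrue {ψ} (v , b) t w c e with single-just v b w c e
... | refl , refl = signed-true b (ψ w) (trans (sym (litVal-signed ψ w b)) (T⇒≡ t))

unit-shrinks : ∀ G x → (x ∷ []) ∈ G → length (setTrue x * G) < length G
unit-shrinks G x m rewrite length-map (applyC (setTrue x)) (filter (λ C → T? (not (satByφ (setTrue x) C))) G) =
  filter-notAll (λ C → T? (not (satByφ (setTrue x) C))) G (Any.map (λ { refl → unit-removed }) m)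
  where
  unit-removed : ¬ T (not (satByφ (setTrue x) (x ∷ [])))
  unit-removed rewrite setTrue-self x = λ ()

data R1Outcome (F : ClauseSet) (ρ : Var → Maybe Bool) (R : ClauseSet) : Set where
  refuted : R ≡ [] ∷ [] → (∀ ψ → ψ ⊒ ρ → ¬ SatCS ψ F) → R1Outcome F ρ R
  stable  : ∀ ρ' → ρ ⊑ ρ' → R ≡ ρ' * F →
            hasEmpty (ρ' * F) ≡ false → findUnit (ρ' * F) ≡ nothing →
            (∀ ψ → ψ ⊒ ρ → SatCS ψ F → ψ ⊒ ρ') → R1Outcome F ρ R

R1Outcome-step : ∀ {F ρ R} x → (x ∷ []) ∈ ρ * F → R1Outcome F (ρ ▹ setTrue x) R → R1Outcome F ρ R
R1Outcome-step {F} {ρ} x unit = lift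
  where
  forced : ∀ ψ → ψ ⊒ ρ → SatCS ψ F → ψ ⊒ (ρ ▹ setTrue x)
  forced ψ h s with All.lookup (apply-model h F s) unit
  ... | here t = ⊒-▹ h (λ w c _ → ⊒-setTrue x t w c)
  lift : ∀ {R} → R1Outcome F (ρ ▹ setTrue x) R → R1Outcome F ρ R
  lift (refuted q f) = refuted q (λ ψ h s → f ψ (forced ψ h s) s)
  lift (stable ρ' ex q he fu g) =
    stable ρ' (⊑-trans (⊑-▹ ρ (setTrue x)) ex) q he fu (λ ψ h s → g ψ (forced ψ h s) s)

empty-unsat : ∀ {ψ} G → [] ∈ G → ¬ SatCS ψ G
empty-unsat G m s with All.lookup s m
... | ()

no-unit-in-[] : ∀ G → length G ≤ zero → findUnit G ≡ nothing
no-unit-in-[] [] _ = refl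

r1fuel-outcome : ∀ n F ρ → length (ρ * F) ≤ n → R1Outcome F ρ (r1fuel n (ρ * F))
r1fuel-outcome n F ρ le with hasEmpty (ρ * F) in he
... | true = refuted refl (λ ψ h s → empty-unsat (ρ * F) (hasEmpty-true (ρ * F) he) (apply-model h F s))
r1fuel-outcome zero F ρ le | false =
  stable ρ (λ _ _ q → q) refl he (no-unit-in-[] (ρ * F) le) (λ _ h _ → h)
r1fuel-outcome (suc n) F ρ le | false with findUnit (ρ * F) in fu
... | nothing = stable ρ (λ _ _ q → q) refl he fu (λ _ h _ → h)
... | just x rewrite apply-▹ ρ (setTrue x) F =
  R1Outcome-step x unit (r1fuel-outcome n F (ρ ▹ setTrue x) (≤-pred (<-≤-trans shrinks le)))
  where
  unit = findUnit-just (ρ * F) x fu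
  shrinks : length ((ρ ▹ setTrue x) * F) < length (ρ * F)
  shrinks = subst (λ G → length G < length (ρ * F)) (apply-▹ ρ (setTrue x) F) (unit-shrinks (ρ * F) x unit)

r₁-outcome : ∀ F ρ → R1Outcome F ρ (r₁ (ρ * F))
r₁-outcome F ρ = r1fuel-outcome (length (ρ * F)) F ρ ≤-refl

xorVal-cong : ∀ {ψ ψ'} E → (∀ v → v ∈ vars E → ψ v ≡ ψ' v) → xorVal ψ E ≡ xorVal ψ' E
xorVal-cong [] h = refl
xorVal-cong (x ∷ E) h =
  cong₂ _xor_ (litVal-cong x (h (var x) (here refl))) (xorVal-cong E (λ w m → h w (there m)))

∉⇒All≢ : ∀ {A : Set} {y : A} {L : List A} → y ∉ L → All (y ≢_) L
∉⇒All≢ {L = L} n = All.tabulate (λ {z} m e → n (subst (_∈ L) (sym e) m))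

All≢⇒∉ : ∀ {A : Set} {y : A} {L : List A} → All (y ≢_) L → y ∉ L
All≢⇒∉ (n ∷ _) (here refl) = n refl
All≢⇒∉ (_ ∷ a) (there m) = All≢⇒∉ a m

xorVal-flip : ∀ ψ E u → Unique (vars E) → u ∈ vars E →
  xorVal (update ψ u (not (ψ u))) E ≡ not (xorVal ψ E)
xorVal-flip ψ ((v , b) ∷ E) u (fresh ∷ _) (here refl)
  rewrite litVal-signed (update ψ u (not (ψ u))) u b | update-here ψ u (not (ψ u)) | litVal-signed ψ u b
        | xorVal-cong {update ψ u (not (ψ u))} {ψ} E
            (λ w m → update-elsewhere ψ u _ w (λ e → All≢⇒∉ fresh (subst (_∈ vars E) e m)))
  = trans (cong (_xor xorVal ψ E) (signed-negate b (ψ u))) (sym (not-distribˡ-xor (signed b (ψ u)) (xorVal ψ E)))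
  where
  signed-negate : ∀ b c → signed b (not c) ≡ not (signed b c)
  signed-negate true c = refl
  signed-negate false c = refl
xorVal-flip ψ ((v , b) ∷ E) u (fresh ∷ distinct) (there m)
  rewrite litVal-cong {update ψ u (not (ψ u))} {ψ} (v , b)
            (update-elsewhere ψ u (not (ψ u)) v (λ e → All≢⇒∉ fresh (subst (_∈ vars E) (sym e) m)))
        | xorVal-flip ψ E u distinct m
  = sym (not-distribʳ-xor (litVal ψ (v , b)) (xorVal ψ E))

unique-↭ : ∀ {A : Set} {xs ys : List A} → xs ↭ ys → Unique xs → Unique ys
unique-↭ {A} p u = ↭ₛ.Unique-resp-↭ (setoid A) (↭⇒↭ₛ p) u

unique-++ˡ : ∀ {A : Set} (xs : List A) {ys} → Unique (xs ++ ys) → Unique xs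
unique-++ˡ [] _ = []
unique-++ˡ (x ∷ xs) (h ∷ t) = All.tabulate (λ m → All.lookup h (∈-++⁺ˡ m)) ∷ unique-++ˡ xs t

unique-++ʳ : ∀ {A : Set} (xs : List A) {ys} → Unique (xs ++ ys) → Unique ys
unique-++ʳ [] u = u
unique-++ʳ (x ∷ xs) (h ∷ t) = unique-++ʳ xs t

unique-++-disjoint : ∀ {A : Set} (xs : List A) {ys z} → Unique (xs ++ ys) → z ∈ xs → z ∉ ys
unique-++-disjoint (x ∷ xs) (h ∷ t) (here refl) m = All≢⇒∉ h (∈-++⁺ʳ xs m)
unique-++-disjoint (x ∷ xs) (h ∷ t) (there m) m' = unique-++-disjoint xs t m m'

unique-same-↭ : ∀ {A : Set} {xs ys : List A} → Unique xs → Unique ys → (∀ {x} → x ∈ xs ⇔ x ∈ ys) → xs ↭ ys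
unique-same-↭ u v e = ∼bag⇒↭ (unique∧set⇒bag u v e)

filter-split-↭ : ∀ {A : Set} {P : A → Set} (P? : Decidable P) xs →
  xs ↭ filter P? xs ++ filter (λ x → ¬? (P? x)) xs
filter-split-↭ P? [] = ↭.refl
filter-split-↭ P? (x ∷ xs) with does (P? x)
... | true = ↭.prep x (filter-split-↭ P? xs)
... | false = ↭.trans (↭.prep x (filter-split-↭ P? xs)) (↭-sym (↭-shift x (filter P? xs) _))

filter-cong-∈ : ∀ {A : Set} {P Q : A → Set} (P? : Decidable P) (Q? : Decidable Q) xs →
  (∀ x → x ∈ xs → (P x → Q x) × (Q x → P x)) → filter P? xs ≡ filter Q? xs
filter-cong-∈ P? Q? [] h = refl
filter-cong-∈ P? Q? (x ∷ xs) h with P? x | Q? x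
... | yes _ | yes _ = cong (x ∷_) (filter-cong-∈ P? Q? xs (λ y m → h y (there m)))
... | no _ | no _ = filter-cong-∈ P? Q? xs (λ y m → h y (there m))
... | yes p | no ¬q = ⊥-elim (¬q (proj₁ (h x (here refl)) p))
... | no ¬p | yes q = ⊥-elim (¬p (proj₂ (h x (here refl)) q))

vars-↭ : ∀ {K K'} → K ↭ K' → ∀ {z} → z ∈ vars K → z ∈ vars K'
vars-↭ p m = ∈-resp-↭ (↭-map⁺ var p) m

vars-++ : ∀ (L M : List Lit) → vars (L ++ M) ≡ vars L ++ vars M
vars-++ L M = map-++ var L M

varsS-++⁻ : ∀ (A B : XClauseSet) {z} → z ∈ varsS (A ++ B) → z ∈ varsS A ⊎ z ∈ varsS B
varsS-++⁻ A B {z} m = ∈-++⁻ (varsS A) (subst (z ∈_) (concatMap-++ vars A B) m)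

varsS-++ˡ : ∀ (A B : XClauseSet) {z} → z ∈ varsS A → z ∈ varsS (A ++ B)
varsS-++ˡ A B {z} m = subst (z ∈_) (sym (concatMap-++ vars A B)) (∈-++⁺ˡ m)

varsS-++ʳ : ∀ (A B : XClauseSet) {z} → z ∈ varsS B → z ∈ varsS (A ++ B)
varsS-++ʳ A B {z} m = subst (z ∈_) (sym (concatMap-++ vars A B)) (∈-++⁺ʳ (varsS A) m)

xorVal-++ : ∀ ψ L M → xorVal ψ (L ++ M) ≡ xorVal ψ L xor xorVal ψ M
xorVal-++ ψ [] M = refl
xorVal-++ ψ (x ∷ L) M = trans (cong (litVal ψ x xor_) (xorVal-++ ψ L M)) (sym (xor-assoc (litVal ψ x) _ _))

xorVal-↭ : ∀ ψ {L L'} → L ↭ L' → xorVal ψ L ≡ xorVal ψ L'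
xorVal-↭ ψ ↭.refl = refl
xorVal-↭ ψ (↭.prep x p) = cong (litVal ψ x xor_) (xorVal-↭ ψ p)
xorVal-↭ ψ (↭.swap x y p) =
  trans (sym (xor-assoc (litVal ψ x) (litVal ψ y) _))
    (trans (cong₂ _xor_ (xor-comm (litVal ψ x) (litVal ψ y)) (xorVal-↭ ψ p)) (xor-assoc (litVal ψ y) (litVal ψ x) _))
xorVal-↭ ψ (↭.trans p q) = trans (xorVal-↭ ψ p) (xorVal-↭ ψ q)

XSat-↭ : ∀ {ψ K K'} → K ↭ K' → XSat ψ K → XSat ψ K'
XSat-↭ {ψ} p e = trans (sym (xorVal-↭ ψ p)) e

xorVal-+s : ∀ ψ L s → xorVal ψ (L ++ pos s ∷ []) ≡ xorVal ψ L xor ψ s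
xorVal-+s ψ L s = trans (xorVal-++ ψ L (pos s ∷ [])) (cong (xorVal ψ L xor_) (xor-identityʳ (ψ s)))

-- A total assignment ψ falsifies exactly one signing of vars E, namely
-- falsifier ψ (vars E); its number of complemented literals has the
-- parity of xorVal ψ E relative to E, so it lies in X₀(E) iff ψ violates E.

falsifier : (Var → Bool) → List Var → Clause
falsifier ψ vs = map (λ v → v , not (ψ v)) vs

vars-falsifier : ∀ ψ vs → vars (falsifier ψ vs) ≡ vs
vars-falsifier ψ [] = refl
vars-falsifier ψ (v ∷ vs) = cong (v ∷_) (vars-falsifier ψ vs)

falsifier-∈ : ∀ ψ vs → falsifier ψ vs ∈ allSignings vs
falsifier-∈ ψ [] = here refl
falsifier-∈ ψ (v ∷ vs) with ψ v
... | true = ∈-++⁺ʳ (map ((v , true) ∷_) (allSignings vs)) (∈-map⁺ ((v , false) ∷_) (falsifier-∈ ψ vs))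
... | false = ∈-++⁺ˡ (∈-map⁺ ((v , true) ∷_) (falsifier-∈ ψ vs))

falsifier-unsat : ∀ ψ vs → ¬ SatClause ψ (falsifier ψ vs)
falsifier-unsat ψ (v ∷ vs) (here p) = subst T (trans (litVal-signed ψ v (not (ψ v))) (signed-not (ψ v))) p
falsifier-unsat ψ (v ∷ vs) (there q) = falsifier-unsat ψ vs q

allSignings-∷⁻ : ∀ v vs K → K ∈ allSignings (v ∷ vs) →
  ∃₂ λ b K' → K ≡ (v , b) ∷ K' × K' ∈ allSignings vs
allSignings-∷⁻ v vs K m with ∈-++⁻ (map ((v , true) ∷_) (allSignings vs)) m
... | inj₁ m' with ∈-map⁻ _ m'
...   | K' , m'' , refl = true , K' , refl , m''
allSignings-∷⁻ v vs K m | inj₂ m' with ∈-map⁻ _ m'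
...   | K' , m'' , refl = false , K' , refl , m''

vars-allSignings : ∀ vs K → K ∈ allSignings vs → vars K ≡ vs
vars-allSignings [] K (here refl) = refl
vars-allSignings (v ∷ vs) K m with allSignings-∷⁻ v vs K m
... | b , K' , refl , m' = cong (v ∷_) (vars-allSignings vs K' m')

unsat-signing : ∀ ψ vs K → K ∈ allSignings vs → ¬ SatClause ψ K → K ≡ falsifier ψ vs
unsat-signing ψ [] K (here refl) n = refl
unsat-signing ψ (v ∷ vs) K m n with allSignings-∷⁻ v vs K m
... | b , K' , refl , m' =
  cong₂ (λ b L → (v , b) ∷ L)
    (signed-false b (ψ v) (trans (sym (litVal-signed ψ v b)) (¬T⇒≡ (λ t → n (here t)))))
    (unsat-signing ψ vs K' m' (λ s → n (there s)))

parityOf : List Lit → Bool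
parityOf K = parity (negCount K)

xor-interchange : ∀ a b c d → (a xor not b) xor (c xor d) ≡ (not b xor c) xor (a xor d)
xor-interchange true true true true = refl
xor-interchange true true true false = refl
xor-interchange true true false true = refl
xor-interchange true true false false = refl
xor-interchange true false true true = refl
xor-interchange true false true false = refl
xor-interchange true false false true = refl
xor-interchange true false false false = refl
xor-interchange false true true true = refl
xor-interchange false true true false = refl
xor-interchange false true false true = refl
xor-interchange false true false false = refl
xor-interchange false false true true = refl
xor-interchange false false true false = refl
xor-interchange false false false true = refl
xor-interchange false false false false = refl

signed-xor : ∀ b c → signed b c ≡ c xor not b
signed-xor true true = refl
signed-xor true false = refl
signed-xor false true = refl
signed-xor false false = refl

parityOf-∷ : ∀ v b K → parityOf ((v , b) ∷ K) ≡ not b xor parityOf K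
parityOf-∷ v true K = refl
parityOf-∷ v false K = refl

parityOf-falsifier-∷ : ∀ ψ v vs → parityOf (falsifier ψ (v ∷ vs)) ≡ ψ v xor parityOf (falsifier ψ vs)
parityOf-falsifier-∷ ψ v vs with ψ v
... | true = refl
... | false = refl

xorVal-parity : ∀ ψ E → xorVal ψ E ≡ parityOf E xor parityOf (falsifier ψ (vars E))
xorVal-parity ψ [] = refl
xorVal-parity ψ ((v , b) ∷ E)
  rewrite litVal-signed ψ v b | signed-xor b (ψ v) | parityOf-∷ v b E | parityOf-falsifier-∷ ψ v (vars E)
        | xorVal-parity ψ E
  = xor-interchange (ψ v) b (parityOf E) (parityOf (falsifier ψ (vars E)))

X₀-∈⁺ : ∀ C E → E ∈ allSignings (vars C) → parityOf E ≡ not (parityOf C) → E ∈ X₀ C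
X₀-∈⁺ C E m p = ∈-filter⁺ (λ E → parityOf E ≟B not (parityOf C)) m p

X₀-∈⁻ : ∀ C E → E ∈ X₀ C → E ∈ allSignings (vars C) × parityOf E ≡ not (parityOf C)
X₀-∈⁻ C E m = ∈-filter⁻ (λ E → parityOf E ≟B not (parityOf C)) m

xor-true : ∀ a b → a xor b ≡ true → b ≡ not a
xor-true true false _ = refl
xor-true false true _ = refl

xor-false : ∀ a b → a xor b ≡ false → b ≡ a
xor-false true true _ = refl
xor-false false false _ = refl

violated-falsifier : ∀ ψ C → xorVal ψ C ≡ true → falsifier ψ (vars C) ∈ X₀ C
violated-falsifier ψ C e =
  X₀-∈⁺ C _ (falsifier-∈ ψ (vars C)) (xor-true _ _ (trans (sym (xorVal-parity ψ C)) e))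

X₀-sound : ∀ ψ C → SatCS ψ (X₀ C) → XSat ψ C
X₀-sound ψ C s with xorVal ψ C in e
... | false = refl
... | true = ⊥-elim (falsifier-unsat ψ (vars C) (All.lookup s (violated-falsifier ψ C e)))

X₀-complete : ∀ ψ C → XSat ψ C → SatCS ψ (X₀ C)
X₀-complete ψ C e = All.tabulate satisfied
  where
  satisfied : ∀ {K} → K ∈ X₀ C → SatClause ψ K
  satisfied {K} m with X₀-∈⁻ C K m | Any.any? (λ x → T? (litVal ψ x)) K
  ... | _ | yes s = s
  ... | signing , p | no n rewrite unsat-signing ψ (vars C) K signing n =
    ⊥-elim (not-self (parityOf C) (trans (sym (xor-false _ _ (trans (sym (xorVal-parity ψ C)) e))) p))
    where
    not-self : ∀ a → a ≢ not a
    not-self true ()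
    not-self false ()

X₀*-sound : ∀ ψ S → SatCS ψ (concatMap X₀ S) → All (XSat ψ) S
X₀*-sound ψ [] _ = []
X₀*-sound ψ (C ∷ S) s = X₀-sound ψ C (++⁻ˡ (X₀ C) s) ∷ X₀*-sound ψ S (++⁻ʳ (X₀ C) s)

X₀*-complete : ∀ ψ S → All (XSat ψ) S → SatCS ψ (concatMap X₀ S)
X₀*-complete ψ [] _ = []
X₀*-complete ψ (C ∷ S) (e ∷ a) = ++⁺ (X₀-complete ψ C e) (X₀*-complete ψ S a)

-- X₀ is propagation-complete for a single XOR-clause
--
-- If ρ * X₀(E) contains neither ⊥ nor a unit clause, then either every
-- extension of ρ satisfies E, or E has at least two variables left open
-- by ρ: with no open variable and ρ violating E the falsifier of E would
-- remain as ⊥, and with exactly one open variable, choosing its value so as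
-- to violate E, the falsifier would remain as a unit clause.

Settled : (Var → Maybe Bool) → XClause → Set
Settled ρ E = (∀ ψ → ψ ⊒ ρ → XSat ψ E) ⊎
  (∃₂ λ u₁ u₂ → u₁ ≢ u₂ × u₁ ∈ vars E × u₂ ∈ vars E × ρ u₁ ≡ nothing × ρ u₂ ≡ nothing)

isOpen : Maybe Bool → Bool
isOpen nothing = true
isOpen (just _) = false

openVars : (Var → Maybe Bool) → List Var → List Var
openVars ρ vs = filter (λ v → T? (isOpen (ρ v))) vs

openVars-∈⁺ : ∀ ρ vs u → u ∈ vs → ρ u ≡ nothing → u ∈ openVars ρ vs
openVars-∈⁺ ρ vs u m e = ∈-filter⁺ (λ v → T? (isOpen (ρ v))) m (subst (λ z → T (isOpen z)) (sym e) tt)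

openVars-∈⁻ : ∀ ρ vs u → u ∈ openVars ρ vs → u ∈ vs × ρ u ≡ nothing
openVars-∈⁻ ρ vs u m with ∈-filter⁻ (λ v → T? (isOpen (ρ v))) m
... | m' , t = m' , is-open (ρ u) t
  where
  is-open : ∀ z → T (isOpen z) → z ≡ nothing
  is-open nothing _ = refl

applyC-falsifier : ∀ {ψ ρ} → ψ ⊒ ρ → ∀ vs → applyC ρ (falsifier ψ vs) ≡ falsifier ψ (openVars ρ vs)
applyC-falsifier h [] = refl
applyC-falsifier {ψ} {ρ} h (v ∷ vs) with litView ρ v (not (ψ v))
... | open-lit e₁ e₂ rewrite applyC-∷ ρ (v , not (ψ v)) (falsifier ψ vs) | e₂
      | filter-T (λ v → isOpen (ρ v)) v vs | e₁ = cong ((v , not (ψ v)) ∷_) (applyC-falsifier h vs)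
... | set-lit c e₁ e₂ rewrite applyC-∷ ρ (v , not (ψ v)) (falsifier ψ vs) | e₂
      | filter-T (λ v → isOpen (ρ v)) v vs | e₁ | h v c e₁ | signed-not c = applyC-falsifier h vs

satByφ-falsifier : ∀ {ψ ρ} → ψ ⊒ ρ → ∀ vs → satByφ ρ (falsifier ψ vs) ≡ false
satByφ-falsifier h [] = refl
satByφ-falsifier {ψ} {ρ} h (v ∷ vs) with litView ρ v (not (ψ v))
... | open-lit e₁ e₂ rewrite e₂ = satByφ-falsifier h vs
... | set-lit c e₁ e₂ rewrite e₂ | h v c e₁ | signed-not c = satByφ-falsifier h vs

stable⇒settled : ∀ ρ S E → E ∈ S → Unique (vars E) →
  hasEmpty (ρ * concatMap X₀ S) ≡ false → findUnit (ρ * concatMap X₀ S) ≡ nothing → Settled ρ E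
stable⇒settled ρ S E E∈S distinct no-empty no-unit = by-open-vars (openVars ρ (vars E)) refl
  where
  F = concatMap X₀ S
  ψ₀ = fill ρ (λ _ → false)
  residue : ∀ ψ → ψ ⊒ ρ → xorVal ψ E ≡ true → falsifier ψ (openVars ρ (vars E)) ∈ ρ * F
  residue ψ h e = subst (_∈ ρ * F) (applyC-falsifier h (vars E))
    (applyC-∈ ρ F _ (∈-concatMap⁺ X₀ (Any.map (λ { refl → violated-falsifier ψ E e }) E∈S))
      (satByφ-falsifier h (vars E)))
  by-open-vars : ∀ L → openVars ρ (vars E) ≡ L → Settled ρ E
  by-open-vars [] q with xorVal ψ₀ E in e
  ... | false = inj₁ (λ ψ h → trans (xorVal-cong E (agree ψ h)) e)
    where
    agree : ∀ ψ → ψ ⊒ ρ → ∀ v → v ∈ vars E → ψ v ≡ ψ₀ v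
    agree ψ h v m with ρ v in eq
    ... | just c = h v c eq
    ... | nothing with () ← subst (v ∈_) q (openVars-∈⁺ ρ (vars E) v m eq)
  ... | true = ⊥-elim (hasEmpty-false (ρ * F) no-empty
                 (subst (λ L → falsifier ψ₀ L ∈ ρ * F) q (residue ψ₀ (fill-⊒ ρ _) e)))
  by-open-vars (u ∷ []) q = ⊥-elim (findUnit-nothing (ρ * F) _ no-unit
      (subst (λ L → falsifier ψ₁ L ∈ ρ * F) q (residue ψ₁ ψ₁⊒ρ violated)))
    where
    u-open = openVars-∈⁻ ρ (vars E) u (subst (u ∈_) (sym q) (here refl))
    ψ₁ : Var → Bool
    ψ₁ = if xorVal ψ₀ E then ψ₀ else update ψ₀ u (not (ψ₀ u))
    ψ₁⊒ρ : ψ₁ ⊒ ρ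
    ψ₁⊒ρ with xorVal ψ₀ E
    ... | true = fill-⊒ ρ _
    ... | false = update-⊒ u _ (fill-⊒ ρ _) (proj₂ u-open)
    violated : xorVal ψ₁ E ≡ true
    violated with xorVal ψ₀ E in eq
    ... | true = eq
    ... | false = trans (xorVal-flip ψ₀ E u distinct (proj₁ u-open)) (cong not eq)
  by-open-vars (u₁ ∷ u₂ ∷ L) q =
    inj₂ (u₁ , u₂ , u₁≢u₂ , proj₁ o₁ , proj₁ o₂ , proj₂ o₁ , proj₂ o₂)
    where
    u₁≢u₂ : u₁ ≢ u₂
    u₁≢u₂ with subst Unique q (Unique.filter⁺ (λ v → T? (isOpen (ρ v))) distinct)
    ... | (u₁≢u₂ ∷ _) ∷ _ = u₁≢u₂
    o₁ = openVars-∈⁻ ρ (vars E) u₁ (subst (u₁ ∈_) (sym q) (here refl))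
    o₂ = openVars-∈⁻ ρ (vars E) u₂ (subst (u₂ ∈_) (sym q) (there (here refl)))

-- Extendable XOR-clause-sets
--
-- Single clauses are extendable, and extendability survives
-- gluing two sets that share at most one variable; an acyclic set such as
-- the splitting used in X₂ is therefore extendable.  This is the heart of
-- the absolute forcing property: a stable propagation state has a model
-- (no hidden unsatisfiability) and forces no further literal.

Extendable : XClauseSet → Set
Extendable S = ∀ ρ → All (Settled ρ) S → ∀ v b →
  ∃ λ ψ → ψ ⊒ ρ × All (XSat ψ) S × (ρ v ≡ nothing → ψ v ≡ b)

repair : ∀ {ρ} ψ E u → ψ ⊒ ρ → Unique (vars E) → u ∈ vars E → ρ u ≡ nothing →
  ∃ λ ψ' → ψ' ⊒ ρ × XSat ψ' E × (∀ w → w ≢ u → ψ' w ≡ ψ w)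
repair ψ E u h distinct u∈E u-open with xorVal ψ E in eq
... | false = ψ , h , eq , (λ _ _ → refl)
... | true = update ψ u (not (ψ u)) , update-⊒ u _ h u-open ,
             trans (xorVal-flip ψ E u distinct u∈E) (cong not eq) , (λ w w≢u → update-elsewhere ψ u _ w w≢u)

open-avoiding : ∀ {ρ : Var → Maybe Bool} {E} v u₁ u₂ → u₁ ≢ u₂ → u₁ ∈ vars E → u₂ ∈ vars E →
  ρ u₁ ≡ nothing → ρ u₂ ≡ nothing → ∃ λ u → u ∈ vars E × ρ u ≡ nothing × v ≢ u
open-avoiding v u₁ u₂ u₁≢u₂ m₁ m₂ o₁ o₂ with v ≟ℕ u₁
... | yes refl = u₂ , m₂ , o₂ , u₁≢u₂
... | no v≢u₁ = u₁ , m₁ , o₁ , v≢u₁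

extendable-single : ∀ E → Unique (vars E) → Extendable (E ∷ [])
extendable-single E distinct ρ (inj₁ entailed ∷ []) v b =
  fill ρ (λ _ → b) , fill-⊒ ρ _ , entailed _ (fill-⊒ ρ _) ∷ [] , fill-open ρ _ v
extendable-single E distinct ρ (inj₂ (u₁ , u₂ , u₁≢u₂ , m₁ , m₂ , o₁ , o₂) ∷ []) v b
  with open-avoiding v u₁ u₂ u₁≢u₂ m₁ m₂ o₁ o₂
... | u , m , o , v≢u with repair (fill ρ (λ _ → b)) E u (fill-⊒ ρ _) distinct m o
...   | ψ , h , s , same = ψ , h , s ∷ [] , (λ e → trans (same v v≢u) (fill-open ρ _ v e))

varsS-∈ : ∀ {x E} S → E ∈ S → x ∈ vars E → x ∈ varsS S
varsS-∈ S E∈S x∈E = ∈-concatMap⁺ vars (Any.map (λ { refl → x∈E }) E∈S)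

models-cong : ∀ {ψ ψ'} S → (∀ x → x ∈ varsS S → ψ x ≡ ψ' x) → All (XSat ψ') S → All (XSat ψ) S
models-cong S agree models = All.tabulate (λ {E} E∈S →
  trans (xorVal-cong E (λ x x∈E → agree x (varsS-∈ S E∈S x∈E))) (All.lookup models E∈S))

glue : List Var → (Var → Bool) → (Var → Bool) → Var → Bool
glue V ψA ψB x = if ⌊ x ∈? V ⌋ then ψA x else ψB x

glue-in : ∀ V ψA ψB x → x ∈ V → glue V ψA ψB x ≡ ψA x
glue-in V ψA ψB x m with x ∈? V
... | yes _ = refl
... | no x∉V = ⊥-elim (x∉V m)

glue-out : ∀ V ψA ψB x → x ∉ V → glue V ψA ψB x ≡ ψB x
glue-out V ψA ψB x x∉V with x ∈? V
... | yes m = ⊥-elim (x∉V m)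
... | no _ = refl

glue-⊒ : ∀ {ρ} V ψA ψB → ψA ⊒ ρ → ψB ⊒ ρ → glue V ψA ψB ⊒ ρ
glue-⊒ V ψA ψB hA hB x c e with x ∈? V
... | yes _ = hA x c e
... | no _ = hB x c e

glue-models : ∀ {ρ} A B w → (∀ x → x ∈ varsS A → x ∈ varsS B → x ≡ w) →
  ∀ ψA ψB → ψA ⊒ ρ → ψB ⊒ ρ → All (XSat ψA) A → All (XSat ψB) B → (ρ w ≡ nothing → ψA w ≡ ψB w) →
  glue (varsS A) ψA ψB ⊒ ρ × All (XSat (glue (varsS A) ψA ψB)) (A ++ B)
glue-models {ρ} A B w shared ψA ψB hA hB sA sB agree-open =
  glue-⊒ (varsS A) ψA ψB hA hB ,
  ++⁺ (models-cong A (glue-in (varsS A) ψA ψB) sA) (models-cong B on-B sB)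
  where
  agree : ψA w ≡ ψB w
  agree with ρ w in e
  ... | nothing = agree-open refl
  ... | just c = trans (hA w c e) (sym (hB w c e))
  on-B : ∀ x → x ∈ varsS B → glue (varsS A) ψA ψB x ≡ ψB x
  on-B x x∈B with x ∈? varsS A
  ... | yes x∈A rewrite shared x x∈A x∈B = agree
  ... | no _ = refl

-- the side containing v is solved first, then the other side agreeing on w
extendable-++ : ∀ A B w → Extendable A → Extendable B →
  (∀ x → x ∈ varsS A → x ∈ varsS B → x ≡ w) → Extendable (A ++ B)
extendable-++ A B w extA extB shared ρ settled v b with v ∈? varsS A
... | yes v∈A with extA ρ (++⁻ˡ A settled) v b
...   | ψA , hA , sA , vA with extB ρ (++⁻ʳ A settled) w (ψA w)
...     | ψB , hB , sB , wB with glue-models A B w shared ψA ψB hA hB sA sB (λ e → sym (wB e))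
...       | h , s = glue (varsS A) ψA ψB , h , s , (λ e → trans (glue-in (varsS A) ψA ψB v v∈A) (vA e))
extendable-++ A B w extA extB shared ρ settled v b | no v∉A with extB ρ (++⁻ʳ A settled) v b
...   | ψB , hB , sB , vB with extA ρ (++⁻ˡ A settled) w (ψB w)
...     | ψA , hA , sA , wA with glue-models A B w shared ψA ψB hA hB sA sB wA
...       | h , s = glue (varsS A) ψA ψB , h , s , (λ e → trans (glue-out (varsS A) ψA ψB v v∉A) (vB e))

-- The natural splitting of a single XOR-clause
--
-- Chain p x xs ys is the splitting of p ∷ x ∷ xs with new variables ys:
-- {p, x, y₁}, {y₁, x₂, y₂}, …, {y_k, x_last}.

Chain : Lit → Lit → List Lit → List Var → XClauseSet
Chain p x xs ys = splitChain p (x ∷ xs) ys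

data Aligned : List Lit → List Var → Set where
  done : Aligned [] []
  link : ∀ {x xs y ys} → Aligned xs ys → Aligned (x ∷ xs) (y ∷ ys)

aligned : ∀ xs (ys : List Var) → length ys ≡ length xs → Aligned xs ys
aligned [] [] _ = done
aligned (x ∷ xs) (y ∷ ys) e = link (aligned xs ys (suc-injective e))

record ChainOK (p x : Lit) (xs : List Lit) (ys : List Var) : Set where
  field
    distinct : Unique (vars (p ∷ x ∷ xs))
    distinct-new : Unique ys
    new : ∀ z → z ∈ ys → z ∉ vars (p ∷ x ∷ xs)
open ChainOK

chain-next : ∀ {p x x₂ xs y ys} → ChainOK p x (x₂ ∷ xs) (y ∷ ys) → ChainOK (pos y) x₂ xs ys
chain-next {p} {x} {x₂} {xs} {y} {ys} ok = record
  { distinct = ∉⇒All≢ (λ m → new ok y (here refl) (there (there m))) ∷ tail-distinct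
  ; distinct-new = tail-new
  ; new = λ { z m (here refl) → All≢⇒∉ y-fresh m
            ; z m (there m') → new ok z (there m) (there (there m')) } }
  where
  tail-distinct : Unique (vars (x₂ ∷ xs))
  tail-distinct with distinct ok
  ... | _ ∷ _ ∷ r = r
  y-fresh : All (y ≢_) ys
  y-fresh with distinct-new ok
  ... | h ∷ _ = h
  tail-new : Unique ys
  tail-new with distinct-new ok
  ... | _ ∷ t = t

xor-link : ∀ a b c r → a xor (b xor (c xor false)) ≡ false → c xor r ≡ false → a xor (b xor r) ≡ false
xor-link a b c r e₁ e₂ rewrite xor-false c r e₂ =
  trans (cong (λ t → a xor (b xor t)) (sym (xor-identityʳ c))) e₁

xor-link-witness : ∀ a b → a xor (b xor ((a xor b) xor false)) ≡ false
xor-link-witness true true = refl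
xor-link-witness true false = refl
xor-link-witness false true = refl
xor-link-witness false false = refl

xor-link-unique : ∀ a b c d → a xor (b xor (c xor false)) ≡ false → a xor (b xor (d xor false)) ≡ false → c ≡ d
xor-link-unique a b true true _ _ = refl
xor-link-unique a b false false _ _ = refl
xor-link-unique true true true false () _
xor-link-unique true false true false _ ()
xor-link-unique false true true false _ ()
xor-link-unique false false true false () _
xor-link-unique true true false true _ ()
xor-link-unique true false false true () _
xor-link-unique false true false true () _
xor-link-unique false false false true _ ()

chain-sound : ∀ {ψ} p x xs ys → Aligned xs ys → All (XSat ψ) (Chain p x xs ys) → XSat ψ (p ∷ x ∷ xs)
chain-sound p x [] [] done (e ∷ []) = e
chain-sound {ψ} p x (x₂ ∷ xs) (y ∷ ys) (link al) (e ∷ es) =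
  xor-link (litVal ψ p) (litVal ψ x) (ψ y) _ e (chain-sound (pos y) x₂ xs ys al es)

-- a model of the clause extends to a model of its chain by setting each
-- new variable to the XOR of the literals before it
chain-complete : ∀ {ψ} p x xs ys → Aligned xs ys → ChainOK p x xs ys → XSat ψ (p ∷ x ∷ xs) →
  ∃ λ ψ' → (∀ z → z ∉ ys → ψ' z ≡ ψ z) × All (XSat ψ') (Chain p x xs ys)
chain-complete {ψ} p x [] [] done ok e = ψ , (λ _ _ → refl) , e ∷ []
chain-complete {ψ} p x (x₂ ∷ xs) (y ∷ ys) (link al) ok e =
  extend (chain-complete (pos y) x₂ xs ys al (chain-next ok) rest-sat)
  where
  c = litVal ψ p xor litVal ψ x
  ψ₁ = update ψ y c
  y∉rest : ∀ w → w ∈ vars (x₂ ∷ xs) → w ≢ y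
  y∉rest w m w≡y = new ok y (here refl) (there (there (subst (_∈ vars (x₂ ∷ xs)) w≡y m)))
  rest-sat : XSat ψ₁ (pos y ∷ x₂ ∷ xs)
  rest-sat = begin
      ψ₁ y xor xorVal ψ₁ (x₂ ∷ xs)
    ≡⟨ cong₂ _xor_ (update-here ψ y c) (xorVal-cong (x₂ ∷ xs) (λ w m → update-elsewhere ψ y c w (y∉rest w m))) ⟩
      c xor xorVal ψ (x₂ ∷ xs)
    ≡⟨ xor-assoc (litVal ψ p) (litVal ψ x) _ ⟩
      xorVal ψ (p ∷ x ∷ x₂ ∷ xs)
    ≡⟨ e ⟩
      false ∎
    where open ≡-Reasoning
  extend : (∃ λ ψ' → (∀ z → z ∉ ys → ψ' z ≡ ψ₁ z) × All (XSat ψ') (Chain (pos y) x₂ xs ys)) →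
    ∃ λ ψ' → (∀ z → z ∉ y ∷ ys → ψ' z ≡ ψ z) × All (XSat ψ') (Chain p x (x₂ ∷ xs) (y ∷ ys))
  extend (ψ' , same , models) = ψ' , same' , first ∷ models
    where
    same' : ∀ z → z ∉ y ∷ ys → ψ' z ≡ ψ z
    same' z z∉ = trans (same z (λ m → z∉ (there m))) (update-elsewhere ψ y c z (λ q → z∉ (here q)))
    old : ∀ l → var l ∈ vars (p ∷ x ∷ x₂ ∷ xs) → litVal ψ' l ≡ litVal ψ l
    old l m = litVal-cong l (same' (var l) (λ m' → new ok (var l) m' m))
    y-value : ψ' y ≡ c
    y-value = trans (same y (All≢⇒∉ y-fresh)) (update-here ψ y c)
      where
      y-fresh : All (y ≢_) ys
      y-fresh with distinct-new ok
      ... | h ∷ _ = h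
    first : XSat ψ' (p ∷ x ∷ pos y ∷ [])
    first rewrite old p (here refl) | old x (there (here refl)) | y-value =
      xor-link-witness (litVal ψ p) (litVal ψ x)

link-determined : ∀ {ψ₁ ψ₂} p x y → XSat ψ₁ (p ∷ x ∷ pos y ∷ []) → XSat ψ₂ (p ∷ x ∷ pos y ∷ []) →
  ψ₁ (var p) ≡ ψ₂ (var p) → ψ₁ (var x) ≡ ψ₂ (var x) → ψ₁ y ≡ ψ₂ y
link-determined {ψ₁} {ψ₂} p x y e₁ e₂ ap ax =
  xor-link-unique (litVal ψ₁ p) (litVal ψ₁ x) (ψ₁ y) (ψ₂ y) e₁
    (subst₂ (λ u w → u xor (w xor (ψ₂ y xor false)) ≡ false) (litVal-cong p (sym ap)) (litVal-cong x (sym ax)) e₂)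

chain-determined : ∀ {ψ₁ ψ₂} p x xs ys → Aligned xs ys →
  All (XSat ψ₁) (Chain p x xs ys) → All (XSat ψ₂) (Chain p x xs ys) →
  (∀ z → z ∈ vars (p ∷ x ∷ xs) → ψ₁ z ≡ ψ₂ z) → ∀ z → z ∈ varsS (Chain p x xs ys) → ψ₁ z ≡ ψ₂ z
chain-determined p x [] [] done _ _ agree z m with ∈-++⁻ (vars (p ∷ x ∷ [])) m
... | inj₁ m' = agree z m'
chain-determined {ψ₁} {ψ₂} p x (x₂ ∷ xs) (y ∷ ys) (link al) (e₁ ∷ es₁) (e₂ ∷ es₂) agree z m
  with ∈-++⁻ (vars (p ∷ x ∷ pos y ∷ [])) m
... | inj₁ (here refl) = agree _ (here refl)
... | inj₁ (there (here refl)) = agree _ (there (here refl))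
... | inj₁ (there (there (here refl))) =
  link-determined p x y e₁ e₂ (agree _ (here refl)) (agree _ (there (here refl)))
... | inj₂ m' = chain-determined (pos y) x₂ xs ys al es₁ es₂ agree-rest z m'
  where
  agree-rest : ∀ z → z ∈ vars (pos y ∷ x₂ ∷ xs) → ψ₁ z ≡ ψ₂ z
  agree-rest z (here refl) = link-determined p x y e₁ e₂ (agree _ (here refl)) (agree _ (there (here refl)))
  agree-rest z (there m'') = agree z (there (there m''))

chain-vars : ∀ p x xs ys → Aligned xs ys → ∀ z → z ∈ varsS (Chain p x xs ys) → z ∈ vars (p ∷ x ∷ xs) ⊎ z ∈ ys
chain-vars p x [] [] done z m with ∈-++⁻ (vars (p ∷ x ∷ [])) m
... | inj₁ m' = inj₁ m'
chain-vars p x (x₂ ∷ xs) (y ∷ ys) (link al) z m with ∈-++⁻ (vars (p ∷ x ∷ pos y ∷ [])) m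
... | inj₁ (here refl) = inj₁ (here refl)
... | inj₁ (there (here refl)) = inj₁ (there (here refl))
... | inj₁ (there (there (here refl))) = inj₂ (here refl)
... | inj₂ m' with chain-vars (pos y) x₂ xs ys al z m'
...   | inj₁ (here refl) = inj₂ (here refl)
...   | inj₁ (there m'') = inj₁ (there (there m''))
...   | inj₂ m'' = inj₂ (there m'')

chain-covers : ∀ p x xs ys → Aligned xs ys → ∀ z → z ∈ vars (p ∷ x ∷ xs) → z ∈ varsS (Chain p x xs ys)
chain-covers p x [] [] done z m = ∈-++⁺ˡ m
chain-covers p x (x₂ ∷ xs) (y ∷ ys) (link al) z (here refl) = here refl
chain-covers p x (x₂ ∷ xs) (y ∷ ys) (link al) z (there (here refl)) = there (here refl)
chain-covers p x (x₂ ∷ xs) (y ∷ ys) (link al) z (there (there m)) =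
  ∈-++⁺ʳ (vars (p ∷ x ∷ pos y ∷ [])) (chain-covers (pos y) x₂ xs ys al z (there m))

link-distinct : ∀ {p x x₂ xs y ys} → ChainOK p x (x₂ ∷ xs) (y ∷ ys) → Unique (vars (p ∷ x ∷ pos y ∷ []))
link-distinct {p} {x} {y = y} ok = (p≢x ∷ p≢y ∷ []) ∷ (x≢y ∷ []) ∷ [] ∷ []
  where
  p≢x : var p ≢ var x
  p≢x with distinct ok
  ... | (h ∷ _) ∷ _ = h
  p≢y : var p ≢ y
  p≢y q = new ok y (here refl) (here (sym q))
  x≢y : var x ≢ y
  x≢y q = new ok y (here refl) (there (here (sym q)))

chain-distinct : ∀ p x xs ys → Aligned xs ys → ChainOK p x xs ys → All (λ E → Unique (vars E)) (Chain p x xs ys)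
chain-distinct p x [] [] done ok = distinct ok ∷ []
chain-distinct p x (x₂ ∷ xs) (y ∷ ys) (link al) ok =
  link-distinct ok ∷ chain-distinct (pos y) x₂ xs ys al (chain-next ok)

link-shared : ∀ p x x₂ xs y ys → Aligned xs ys → ChainOK p x (x₂ ∷ xs) (y ∷ ys) →
  ∀ z → z ∈ varsS ((p ∷ x ∷ pos y ∷ []) ∷ []) → z ∈ varsS (Chain (pos y) x₂ xs ys) → z ≡ y
link-shared p x x₂ xs y ys al ok z m₁ m₂ with ∈-++⁻ (vars (p ∷ x ∷ pos y ∷ [])) m₁ | chain-vars (pos y) x₂ xs ys al z m₂
... | inj₁ _ | inj₁ (here e) = e
... | inj₁ (there (there (here e))) | _ = e
... | inj₁ (here refl) | inj₁ (there m) = ⊥-elim (All≢⇒∉ p-fresh (there m))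
  where
  p-fresh : All (var p ≢_) (var x ∷ vars (x₂ ∷ xs))
  p-fresh with distinct ok
  ... | h ∷ _ = h
... | inj₁ (there (here refl)) | inj₁ (there m) = ⊥-elim (All≢⇒∉ x-fresh m)
  where
  x-fresh : All (var x ≢_) (vars (x₂ ∷ xs))
  x-fresh with distinct ok
  ... | _ ∷ h ∷ _ = h
... | inj₁ (here refl) | inj₂ m = ⊥-elim (new ok (var p) (there m) (here refl))
... | inj₁ (there (here refl)) | inj₂ m = ⊥-elim (new ok (var x) (there m) (there (here refl)))

chain-extendable : ∀ p x xs ys → Aligned xs ys → ChainOK p x xs ys → Extendable (Chain p x xs ys)
chain-extendable p x [] [] done ok = extendable-single (p ∷ x ∷ []) (distinct ok)
chain-extendable p x (x₂ ∷ xs) (y ∷ ys) (link al) ok =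
  extendable-++ ((p ∷ x ∷ pos y ∷ []) ∷ []) (Chain (pos y) x₂ xs ys) y
    (extendable-single _ (link-distinct ok)) (chain-extendable (pos y) x₂ xs ys al (chain-next ok))
    (link-shared p x x₂ xs y ys al ok)

natSplit-chain : ∀ p x xs ys → Aligned xs ys → natSplit (p ∷ x ∷ xs) ys ≡ Chain p x xs ys
natSplit-chain p x [] [] done = refl
natSplit-chain p x (x₃ ∷ xs) (y ∷ ys) (link al) = refl

record Splitting (K : XClause) (ys : List Var) : Set where
  field
    extendable : Extendable (natSplit K ys)
    sound : ∀ {ψ} → All (XSat ψ) (natSplit K ys) → XSat ψ K
    complete : ∀ {ψ} → XSat ψ K → ∃ λ ψ' → (∀ z → z ∉ ys → ψ' z ≡ ψ z) × All (XSat ψ') (natSplit K ys)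
    determined : ∀ {ψ₁ ψ₂} → All (XSat ψ₁) (natSplit K ys) → All (XSat ψ₂) (natSplit K ys) →
      (∀ z → z ∈ vars K → ψ₁ z ≡ ψ₂ z) → ∀ z → z ∈ varsS (natSplit K ys) → ψ₁ z ≡ ψ₂ z
    split-vars : ∀ z → z ∈ varsS (natSplit K ys) → z ∈ vars K ⊎ z ∈ ys
    covers : ∀ z → z ∈ vars K → z ∈ varsS (natSplit K ys)
    distinct-clauses : All (λ E → Unique (vars E)) (natSplit K ys)

splitting : ∀ K ys → 2 ≤ length K → length ys ≡ length K ∸ 2 → Unique (vars K) → Unique ys →
  (∀ z → z ∈ ys → z ∉ vars K) → Splitting K ys
splitting (_ ∷ []) ys (s≤s ()) len distinct-K distinct-ys new-ys
splitting (p ∷ x ∷ xs) ys _ len distinct-K distinct-ys new-ys = record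
  { extendable = subst Extendable (sym eq) (chain-extendable p x xs ys al ok)
  ; sound = λ a → chain-sound p x xs ys al (subst (All _) eq a)
  ; complete = λ e → let (ψ' , same , a) = chain-complete p x xs ys al ok e in ψ' , same , subst (All _) (sym eq) a
  ; determined = λ a₁ a₂ agree z m →
      chain-determined p x xs ys al (subst (All _) eq a₁) (subst (All _) eq a₂) agree z (subst (λ L → z ∈ varsS L) eq m)
  ; split-vars = λ z m → chain-vars p x xs ys al z (subst (λ L → z ∈ varsS L) eq m)
  ; covers = λ z m → subst (λ L → z ∈ varsS L) (sym eq) (chain-covers p x xs ys al z m)
  ; distinct-clauses = subst (All _) (sym eq) (chain-distinct p x xs ys al ok) }
  where
  al = aligned xs ys len
  ok : ChainOK p x xs ys
  ok = record { distinct = distinct-K ; distinct-new = distinct-ys ; new = new-ys }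
  eq = natSplit-chain p x xs ys al

module _ {K : XClause} (A B : XClause) (K↭A++B : K ↭ A ++ B) where

  xorVal-parts : ∀ ψ → xorVal ψ K ≡ xorVal ψ A xor xorVal ψ B
  xorVal-parts ψ = trans (xorVal-↭ ψ K↭A++B) (xorVal-++ ψ A B)

  length-parts : length K ≡ length A + length B
  length-parts = trans (↭-length K↭A++B) (length-++ A)

  private
    vars-parts : vars K ↭ vars A ++ vars B
    vars-parts = subst (vars K ↭_) (vars-++ A B) (↭-map⁺ var K↭A++B)

  vars-parts⁻ : ∀ {z} → z ∈ vars K → z ∈ vars A ⊎ z ∈ vars B
  vars-parts⁻ m = ∈-++⁻ (vars A) (∈-resp-↭ vars-parts m)

  vars-partˡ : ∀ {z} → z ∈ vars A → z ∈ vars K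
  vars-partˡ m = ∈-resp-↭ (↭-sym vars-parts) (∈-++⁺ˡ m)

  vars-partʳ : ∀ {z} → z ∈ vars B → z ∈ vars K
  vars-partʳ m = ∈-resp-↭ (↭-sym vars-parts) (∈-++⁺ʳ (vars A) m)

  module _ (distinct : Unique (vars K)) where

    private
      distinct-parts : Unique (vars A ++ vars B)
      distinct-parts = unique-↭ vars-parts distinct

    distinct-partˡ : Unique (vars A)
    distinct-partˡ = unique-++ˡ (vars A) distinct-parts

    distinct-partʳ : Unique (vars B)
    distinct-partʳ = unique-++ʳ (vars A) distinct-parts

    disjoint-parts : ∀ {z} → z ∈ vars A → z ∉ vars B
    disjoint-parts = unique-++-disjoint (vars A) distinct-parts

module TwoClauses (C D : XClause) (distinct-C : IsClause C) (distinct-D : IsClause D)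
  (shared : ∀ v → v ∈ vars C → v ∈ vars D → v ∈ vars (C ∩L D)) where

  I C∖I D∖I : XClause
  I = C ∩L D
  C∖I = C ∖L I
  D∖I = D ∖L I

  I-∈⁻ : ∀ {l} → l ∈ I → l ∈ C × l ∈ D
  I-∈⁻ m = ∈-filter⁻ (_∈L? D) m

  I-∈⁺ : ∀ {l} → l ∈ C → l ∈ D → l ∈ I
  I-∈⁺ = ∈-filter⁺ (_∈L? D)

  C-split : C ↭ I ++ C∖I
  C-split = subst (λ L → C ↭ I ++ L) rest≡C∖I (filter-split-↭ (_∈L? D) C)
    where
    rest≡C∖I : filter (λ x → ¬? (x ∈L? D)) C ≡ C∖I
    rest≡C∖I = filter-cong-∈ (λ x → ¬? (x ∈L? D)) (λ x → ¬? (x ∈L? I)) C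
      (λ x m → (λ x∉D x∈I → x∉D (proj₂ (I-∈⁻ x∈I))) , (λ x∉I x∈D → x∉I (I-∈⁺ m x∈D)))

  distinct-I : Unique (vars I)
  distinct-I = distinct-partˡ I C∖I C-split distinct-C

  distinct-C∖I : Unique (vars C∖I)
  distinct-C∖I = distinct-partʳ I C∖I C-split distinct-C

  -- the literals of D lying in I are, up to order, I itself
  D-split : D ↭ I ++ D∖I
  D-split = ↭.trans (filter-split-↭ (_∈L? I) D) (↭-++⁺ʳ D∖I D∩I↭I)
    where
    D∩I↭I : filter (_∈L? I) D ↭ I
    D∩I↭I = unique-same-↭ (Unique.filter⁺ (_∈L? I) (Unique.map⁻ distinct-D)) (Unique.map⁻ distinct-I)
      (mk⇔ (λ m → proj₂ (∈-filter⁻ (_∈L? I) {xs = D} m)) (λ m → ∈-filter⁺ (_∈L? I) (proj₂ (I-∈⁻ m)) m))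

  distinct-D∖I : Unique (vars D∖I)
  distinct-D∖I = distinct-partʳ I D∖I D-split distinct-D

  C∖I-∉I : ∀ {z} → z ∈ vars C∖I → z ∉ vars I
  C∖I-∉I m m' = disjoint-parts I C∖I C-split distinct-C m' m

  D∖I-∉I : ∀ {z} → z ∈ vars D∖I → z ∉ vars I
  D∖I-∉I m m' = disjoint-parts I D∖I D-split distinct-D m' m

  C∖I-∉D∖I : ∀ {z} → z ∈ vars C∖I → z ∉ vars D∖I
  C∖I-∉D∖I m m' = C∖I-∉I m (shared _ (vars-partʳ I C∖I C-split m) (vars-partʳ I D∖I D-split m'))

  xor-cancel : ∀ a b t → a xor t ≡ false → b xor t ≡ false → a xor b ≡ false
  xor-cancel a b t e₁ e₂ = trans (cong (a xor_) (trans (sym (xor-false b t e₂)) (xor-false a t e₁))) (xor-same a)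

  -- Since C = I ⊕ C∖I and D = I ⊕ D∖I, setting s := ⊕I turns models of
  -- {C, D} into models of {I', C', D'}, and conversely.
  module Linked (s : Var) (s∉C : s ∉ vars C) (s∉D : s ∉ vars D) where

    _+s : XClause → XClause
    X +s = X ++ pos s ∷ []

    I' C' D' : XClause
    I' = I +s
    C' = C∖I +s
    D' = D∖I +s

    represents : Represents (I' ∷ C' ∷ D' ∷ []) (C ∷ D ∷ [])
    represents ψ = mk⇔ to from
      where
      to : XSatS ψ (C ∷ D ∷ []) →
        ∃ λ ψ' → (∀ v → v ∈ varsS (C ∷ D ∷ []) → ψ' v ≡ ψ v) × XSatS ψ' (I' ∷ C' ∷ D' ∷ [])
      to (sat-C ∷ sat-D ∷ []) = ψ' , agree , sat-I' ∷ sat-C' ∷ sat-D' ∷ []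
        where
        xI = xorVal ψ I
        ψ' = update ψ s xI
        linked : ∀ L → (∀ {v} → v ∈ vars L → v ≢ s) → xorVal ψ' (L +s) ≡ xorVal ψ L xor xI
        linked L s∉L = trans (xorVal-+s ψ' L s)
          (cong₂ _xor_ (xorVal-cong L (λ w m → update-elsewhere ψ s xI w (s∉L m))) (update-here ψ s xI))
        s∉C' : ∀ {v} → v ∈ vars C → v ≢ s
        s∉C' m refl = s∉C m
        s∉D' : ∀ {v} → v ∈ vars D → v ≢ s
        s∉D' m refl = s∉D m
        agree : ∀ v → v ∈ varsS (C ∷ D ∷ []) → ψ' v ≡ ψ v
        agree v m with ∈-++⁻ (vars C) m
        ... | inj₁ m-C = update-elsewhere ψ s xI v (s∉C' m-C)
        ... | inj₂ m' with ∈-++⁻ (vars D) m'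
        ...   | inj₁ m-D = update-elsewhere ψ s xI v (s∉D' m-D)
        sat-I' : XSat ψ' I'
        sat-I' = trans (linked I (λ m → s∉C' (vars-partˡ I C∖I C-split m))) (xor-same xI)
        sat-C' : XSat ψ' C'
        sat-C' = trans (linked C∖I (λ m → s∉C' (vars-partʳ I C∖I C-split m)))
          (trans (xor-comm (xorVal ψ C∖I) xI) (trans (sym (xorVal-parts I C∖I C-split ψ)) sat-C))
        sat-D' : XSat ψ' D'
        sat-D' = trans (linked D∖I (λ m → s∉D' (vars-partʳ I D∖I D-split m)))
          (trans (xor-comm (xorVal ψ D∖I) xI) (trans (sym (xorVal-parts I D∖I D-split ψ)) sat-D))
      from : (∃ λ ψ' → (∀ v → v ∈ varsS (C ∷ D ∷ []) → ψ' v ≡ ψ v) × XSatS ψ' (I' ∷ C' ∷ D' ∷ [])) →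
        XSatS ψ (C ∷ D ∷ [])
      from (ψ' , agree , (sat-I' ∷ sat-C' ∷ sat-D' ∷ [])) = sat-C ∷ sat-D ∷ []
        where
        unlinked : ∀ L → XSat ψ' (L +s) → xorVal ψ' L xor ψ' s ≡ false
        unlinked L e = trans (sym (xorVal-+s ψ' L s)) e
        sat-C : XSat ψ C
        sat-C = trans (xorVal-cong C (λ w m → sym (agree w (∈-++⁺ˡ m))))
          (trans (xorVal-parts I C∖I C-split ψ') (xor-cancel (xorVal ψ' I) (xorVal ψ' C∖I) (ψ' s) (unlinked I sat-I') (unlinked C∖I sat-C')))
        sat-D : XSat ψ D
        sat-D = trans (xorVal-cong D (λ w m → sym (agree w (∈-++⁺ʳ (vars C) (∈-++⁺ˡ m)))))
          (trans (xorVal-parts I D∖I D-split ψ') (xor-cancel (xorVal ψ' I) (xorVal ψ' D∖I) (ψ' s) (unlinked I sat-I') (unlinked D∖I sat-D')))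

X₀-covers : ∀ E z → Unique (vars E) → z ∈ vars E → z ∈ varsS (X₀ E)
X₀-covers E z distinct z∈E with xorVal (λ _ → false) E in e
... | true = varsS-∈ (X₀ E) (violated-falsifier _ E e) (subst (z ∈_) (sym (vars-falsifier _ (vars E))) z∈E)
... | false = varsS-∈ (X₀ E) (violated-falsifier ψ₁ E violated) (subst (z ∈_) (sym (vars-falsifier _ (vars E))) z∈E)
  where
  ψ₁ = update (λ _ → false) z true
  violated : xorVal ψ₁ E ≡ true
  violated = trans (xorVal-flip (λ _ → false) E z distinct z∈E) (cong not e)

X₀*-covers : ∀ S z → All (λ E → Unique (vars E)) S → z ∈ varsS S → z ∈ varsS (concatMap X₀ S)
X₀*-covers (E ∷ S) z (d ∷ ds) m with ∈-++⁻ (vars E) m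
... | inj₁ m-E = varsS-++ˡ (X₀ E) (concatMap X₀ S) (X₀-covers E z d m-E)
... | inj₂ m-S = varsS-++ʳ (X₀ E) (concatMap X₀ S) (X₀*-covers S z ds m-S)

X₀*-vars : ∀ S K x → K ∈ concatMap X₀ S → x ∈ K → var x ∈ varsS S
X₀*-vars (E ∷ S) K x m x∈K with ∈-++⁻ (X₀ E) m
... | inj₁ m-E = ∈-++⁺ˡ (subst (var x ∈_) (vars-allSignings (vars E) K (proj₁ (X₀-∈⁻ E K m-E))) (∈-map⁺ var x∈K))
... | inj₂ m-S = ∈-++⁺ʳ (vars E) (X₀*-vars S K x m-S x∈K)

-- Absolute forcing from extendability
--
-- Let S be an extendable XOR-clause-set of clauses with distinct
-- variables that represents F and whose models are determined by their
-- values on var(F).  Then X₀(S) is an absolute forcing representation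
-- of F:  after unit propagation either ⊥ is derived, or the remaining
-- partial assignment settles every clause of S, so by extendability it
-- has a model in which any open variable takes any value; and under a
-- total assignment of var(F) determinedness leaves no variable open.

module AbsoluteForcing (F S : XClauseSet)
  (distinct : All (λ E → Unique (vars E)) S)
  (extendable : Extendable S)
  (covers : ∀ v → v ∈ varsS F → v ∈ varsS S)
  (sound : ∀ ψ → All (XSat ψ) S → XSatS ψ F)
  (complete : ∀ ψ → XSatS ψ F → ∃ λ ψ' → (∀ v → v ∈ varsS F → ψ' v ≡ ψ v) × All (XSat ψ') S)
  (determined : ∀ {ψ₁ ψ₂} → All (XSat ψ₁) S → All (XSat ψ₂) S →
     (∀ v → v ∈ varsS F → ψ₁ v ≡ ψ₂ v) → ∀ z → z ∈ varsS S → ψ₁ z ≡ ψ₂ z)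
  where

  V = varsS F
  F' = concatMap X₀ S

  cnf-representation : CNFRep F F'
  cnf-representation = (λ v m → X₀*-covers S v distinct (covers v m)) , λ ψ → mk⇔ (to ψ) (from ψ)
    where
    to : ∀ ψ → Satisfiable (restrict V ψ * F') → XSatS ψ F
    to ψ sat with satisfiable-apply⇒ (restrict V ψ) F' sat
    ... | ψ' , ψ'⊒ , models = models-cong F (λ v m → sym (ψ'⊒ v (ψ v) (restrict-∈ V ψ v m)))
                                (sound ψ' (X₀*-sound ψ' S models))
    from : ∀ ψ → XSatS ψ F → Satisfiable (restrict V ψ * F')
    from ψ sat with complete ψ sat
    ... | ψ' , agree , models =
      satisfiable-apply⇐ (restrict V ψ) F' ψ' (restrict-⊒ V ψ agree) (X₀*-complete ψ' S models)

  stable-settles : ∀ ρ → hasEmpty (ρ * F') ≡ false → findUnit (ρ * F') ≡ nothing → All (Settled ρ) S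
  stable-settles ρ no-empty no-unit =
    All.tabulate (λ E∈S → stable⇒settled ρ S _ E∈S (All.lookup distinct E∈S) no-empty no-unit)

  forcing : ∀ φ → R1Outcome F' φ (r₁ (φ * F')) →
    (¬ Satisfiable (φ * F') → r₁ (φ * F') ≡ [] ∷ []) × (Satisfiable (φ * F') → NoForcedLits (r₁ (φ * F')))
  forcing φ (refuted ⊥-derived no-model) =
    (λ _ → ⊥-derived) ,
    (λ sat → let (ψ , ψ⊒φ , models) = satisfiable-apply⇒ φ F' sat in ⊥-elim (no-model ψ ψ⊒φ models))
  forcing φ (stable ρ' φ⊑ρ' result no-empty no-unit _) =
    (λ unsat → ⊥-elim (unsat satisfiable)) , (λ _ → subst NoForcedLits (sym result) no-forced)
    where
    settled = stable-settles ρ' no-empty no-unit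
    satisfiable : Satisfiable (φ * F')
    satisfiable with extendable ρ' settled 0 true
    ... | ψ , ψ⊒ρ' , models , _ = satisfiable-apply⇐ φ F' ψ (⊒-⊑ φ⊑ρ' ψ⊒ρ') (X₀*-complete ψ S models)
    -- a model giving v the value not b falsifies the literal (v , b)
    no-forced : NoForcedLits (ρ' * F')
    no-forced (v , b) with extendable ρ' settled v (not b)
    ... | ψ , ψ⊒ρ' , models , v-value = subst Satisfiable (sym (apply-▹ ρ' (setFalse (v , b)) F'))
          (satisfiable-apply⇐ (ρ' ▹ setFalse (v , b)) F' ψ (⊒-▹ ψ⊒ρ' v-set) (X₀*-complete ψ S models))
      where
      v-set : ∀ w c → ρ' w ≡ nothing → single v (not b) w ≡ just c → ψ w ≡ c
      v-set w c open-w e with single-just v (not b) w c e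
      ... | refl , refl = v-value open-w

  total : ∀ ψ → Satisfiable (restrict V ψ * F') → R1Outcome F' (restrict V ψ) (r₁ (restrict V ψ * F')) →
    r₁ (restrict V ψ * F') ≡ []
  total ψ sat (refuted _ no-model) with satisfiable-apply⇒ (restrict V ψ) F' sat
  ... | ψ' , ψ'⊒ , models = ⊥-elim (no-model ψ' ψ'⊒ models)
  total ψ sat (stable ρ' restrict⊑ρ' result no-empty no-unit _) with extendable ρ' settled 0 true
    where settled = stable-settles ρ' no-empty no-unit
  ... | ψ₀ , ψ₀⊒ρ' , models , _ = trans result (apply-total ψ₀⊒ρ' F' assigned (X₀*-complete ψ₀ S models))
    where
    settled = stable-settles ρ' no-empty no-unit
    -- an open variable could take both values in models agreeing on V
    assigned : ∀ K → K ∈ F' → ∀ x → x ∈ K → Assigned ρ' (var x)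
    assigned K K∈F' x x∈K with ρ' (var x) in eq
    ... | just c = c , refl
    ... | nothing with extendable ρ' settled (var x) true | extendable ρ' settled (var x) false
    ...   | ψa , ψa⊒ , models-a , x-true | ψb , ψb⊒ , models-b , x-false =
      ⊥-elim (true≢false (trans (sym (x-true eq)) (trans (determined models-a models-b agree-V (var x) x∈S) (x-false eq))))
      where
      x∈S : var x ∈ varsS S
      x∈S = X₀*-vars S K x K∈F' x∈K
      agree-V : ∀ v → v ∈ V → ψa v ≡ ψb v
      agree-V v m = trans (ψa⊒ v (ψ v) (restrict⊑ρ' v (ψ v) (restrict-∈ V ψ v m)))
                          (sym (ψb⊒ v (ψ v) (restrict⊑ρ' v (ψ v) (restrict-∈ V ψ v m))))
      true≢false : true ≢ false
      true≢false ()

  absolute-forcing : AbsForcingRep F F'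
  absolute-forcing =
    cnf-representation , (λ φ → forcing φ (r₁-outcome F' φ)) , (λ ψ sat → total ψ sat (r₁-outcome F' (restrict V ψ)))

positive-rest : ∀ m n k → m + n ≡ k → m < k → 1 ≤ n
positive-rest m zero k e m<k rewrite +-identityʳ m | e = ⊥-elim (<-irrefl refl m<k)
positive-rest m (suc n) k e m<k = s≤s z≤n

module X₂ (C D : XClause) (distinct-C : IsClause C) (distinct-D : IsClause D)
  (shared : ∀ v → v ∈ vars C → v ∈ vars D → v ∈ vars (C ∩L D))
  (|I|≥2 : 2 ≤ length (C ∩L D)) (|I|<|C| : length (C ∩L D) < length C) (|I|<|D| : length (C ∩L D) < length D)
  (s : Var) (s∉C : s ∉ vars C) (s∉D : s ∉ vars D)
  where

  open TwoClauses C D distinct-C distinct-D shared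
  open Linked s s∉C s∉D

  V W : List Var
  V = varsS (C ∷ D ∷ [])
  W = varsS (I' ∷ C' ∷ D' ∷ [])

  V-C : ∀ {z} → z ∈ vars C → z ∈ V
  V-C = ∈-++⁺ˡ
  V-D : ∀ {z} → z ∈ vars D → z ∈ V
  V-D m = ∈-++⁺ʳ (vars C) (∈-++⁺ˡ m)

  W-I' : ∀ {z} → z ∈ vars I' → z ∈ W
  W-I' = ∈-++⁺ˡ
  W-C' : ∀ {z} → z ∈ vars C' → z ∈ W
  W-C' m = ∈-++⁺ʳ (vars I') (∈-++⁺ˡ m)
  W-D' : ∀ {z} → z ∈ vars D' → z ∈ W
  W-D' m = ∈-++⁺ʳ (vars I') (∈-++⁺ʳ (vars C') (∈-++⁺ˡ m))

  V-parts : ∀ {z} → z ∈ V → z ∈ vars I ⊎ z ∈ vars C∖I ⊎ z ∈ vars D∖I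
  V-parts m with ∈-++⁻ (vars C) m
  ... | inj₁ m-C with vars-parts⁻ I C∖I C-split m-C
  ...   | inj₁ a = inj₁ a
  ...   | inj₂ b = inj₂ (inj₁ b)
  V-parts m | inj₂ m' with ∈-++⁻ (vars D) m'
  ...   | inj₁ m-D with vars-parts⁻ I D∖I D-split m-D
  ...     | inj₁ a = inj₁ a
  ...     | inj₂ c = inj₂ (inj₂ c)

  vars-+s⁻ : ∀ X {z} → z ∈ vars (X +s) → z ∈ vars X ⊎ z ≡ s
  vars-+s⁻ X {z} m with ∈-++⁻ (vars X) (subst (z ∈_) (vars-++ X (pos s ∷ [])) m)
  ... | inj₁ a = inj₁ a
  ... | inj₂ (here e) = inj₂ e

  vars-+s⁺ : ∀ X {z} → z ∈ vars X → z ∈ vars (X +s)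
  vars-+s⁺ X {z} m = subst (z ∈_) (sym (vars-++ X (pos s ∷ []))) (∈-++⁺ˡ m)

  distinct-+s : ∀ X → Unique (vars X) → s ∉ vars X → Unique (vars (X +s))
  distinct-+s X d s∉X =
    subst Unique (sym (vars-++ X (pos s ∷ []))) (Unique.++⁺ d ([] ∷ []) (λ { (m , here refl) → s∉X m }))

  length-+s : ∀ X K → K ↭ X +s → 1 ≤ length X → 2 ≤ length K
  length-+s X K p h rewrite ↭-length p | length-++ X {pos s ∷ []} | +-comm (length X) 1 = s≤s h

  s∉I : s ∉ vars I
  s∉I m = s∉C (vars-partˡ I C∖I C-split m)
  s∉C∖I : s ∉ vars C∖I
  s∉C∖I m = s∉C (vars-partʳ I C∖I C-split m)
  s∉D∖I : s ∉ vars D∖I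
  s∉D∖I m = s∉D (vars-partʳ I D∖I D-split m)

  |C∖I|≥1 : 1 ≤ length C∖I
  |C∖I|≥1 = positive-rest (length I) (length C∖I) (length C) (sym (length-parts I C∖I C-split)) |I|<|C|
  |D∖I|≥1 : 1 ≤ length D∖I
  |D∖I|≥1 = positive-rest (length I) (length D∖I) (length D) (sym (length-parts I D∖I D-split)) |I|<|D|

  module Assembly (I'' C'' D'' : XClause) (I''↭I' : I'' ↭ I') (C''↭C' : C'' ↭ C') (D''↭D' : D'' ↭ D')
    (yI yC yD : List Var)
    (|yI| : length yI ≡ length I' ∸ 2) (|yC| : length yC ≡ length C' ∸ 2) (|yD| : length yD ≡ length D' ∸ 2)
    (distinct-y : Unique (yI ++ yC ++ yD))
    (fresh : ∀ y → y ∈ yI ++ yC ++ yD → y ∉ W)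
    where

    yA : List Var
    yA = yI ++ yC ++ yD

    yI⊆yA : ∀ {z} → z ∈ yI → z ∈ yA
    yI⊆yA = ∈-++⁺ˡ
    yC⊆yA : ∀ {z} → z ∈ yC → z ∈ yA
    yC⊆yA m = ∈-++⁺ʳ yI (∈-++⁺ˡ m)
    yD⊆yA : ∀ {z} → z ∈ yD → z ∈ yA
    yD⊆yA m = ∈-++⁺ʳ yI (∈-++⁺ʳ yC m)

    yI∉yC : ∀ {z} → z ∈ yI → z ∉ yC
    yI∉yC a b = unique-++-disjoint yI distinct-y a (∈-++⁺ˡ b)
    yI∉yD : ∀ {z} → z ∈ yI → z ∉ yD
    yI∉yD a b = unique-++-disjoint yI distinct-y a (∈-++⁺ʳ yC b)
    yC∉yD : ∀ {z} → z ∈ yC → z ∉ yD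
    yC∉yD = unique-++-disjoint yC (unique-++ʳ yI distinct-y)

    piece : ∀ {K} X (ys : List Var) → K ↭ X +s → 1 ≤ length X → length ys ≡ length (X +s) ∸ 2 →
      Unique (vars X) → s ∉ vars X → Unique ys → (∀ {z} → z ∈ ys → z ∈ yA) →
      (∀ {z} → z ∈ vars (X +s) → z ∈ W) → Splitting K ys
    piece {K} X ys K↭X+s |X|≥1 |ys| distinct-X s∉X distinct-ys ys⊆yA X+s⊆W =
      splitting K ys (length-+s X K K↭X+s |X|≥1) (trans |ys| (cong (_∸ 2) (sym (↭-length K↭X+s))))
        (unique-↭ (↭-map⁺ var (↭-sym K↭X+s)) (distinct-+s X distinct-X s∉X)) distinct-ys
        (λ z m m' → fresh z (ys⊆yA m) (X+s⊆W (vars-↭ K↭X+s m')))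

    split-I : Splitting I'' yI
    split-I = piece I yI I''↭I' (≤-trans (s≤s z≤n) |I|≥2) |yI| distinct-I s∉I
      (unique-++ˡ yI distinct-y) yI⊆yA W-I'
    split-C : Splitting C'' yC
    split-C = piece C∖I yC C''↭C' |C∖I|≥1 |yC| distinct-C∖I s∉C∖I
      (unique-++ˡ yC (unique-++ʳ yI distinct-y)) yC⊆yA W-C'
    split-D : Splitting D'' yD
    split-D = piece D∖I yD D''↭D' |D∖I|≥1 |yD| distinct-D∖I s∉D∖I
      (unique-++ʳ yC (unique-++ʳ yI distinct-y)) yD⊆yA W-D'

    open Splitting

    PI PC PD S : XClauseSet
    PI = natSplit I'' yI
    PC = natSplit C'' yC
    PD = natSplit D'' yD
    S = PI ++ PC ++ PD

    support : ∀ {K X ys} → Splitting K ys → K ↭ X +s → ∀ {z} → z ∈ varsS (natSplit K ys) → z ∈ vars (X +s) ⊎ z ∈ ys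
    support sp p {z} m with split-vars sp z m
    ... | inj₁ a = inj₁ (vars-↭ p a)
    ... | inj₂ b = inj₂ b

    only-s-shared : ∀ {X Y : XClause} {yX yY : List Var} {z} → (∀ {w} → w ∈ vars X → w ∉ vars Y) →
      (∀ {w} → w ∈ vars (X +s) → w ∈ W) → (∀ {w} → w ∈ vars (Y +s) → w ∈ W) →
      (∀ {w} → w ∈ yX → w ∈ yA) → (∀ {w} → w ∈ yY → w ∈ yA) → (∀ {w} → w ∈ yX → w ∉ yY) →
      z ∈ vars (X +s) ⊎ z ∈ yX → z ∈ vars (Y +s) ⊎ z ∈ yY → z ≡ s
    only-s-shared {X} {Y} X∩Y X⊆W Y⊆W yX⊆yA yY⊆yA yX∩yY (inj₁ mX) mY with vars-+s⁻ X mX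
    ... | inj₂ z≡s = z≡s
    ... | inj₁ a with mY
    ...   | inj₂ b = ⊥-elim (fresh _ (yY⊆yA b) (X⊆W mX))
    ...   | inj₁ mY' with vars-+s⁻ Y mY'
    ...     | inj₂ z≡s = z≡s
    ...     | inj₁ b = ⊥-elim (X∩Y a b)
    only-s-shared X∩Y X⊆W Y⊆W yX⊆yA yY⊆yA yX∩yY (inj₂ a) (inj₁ mY) = ⊥-elim (fresh _ (yX⊆yA a) (Y⊆W mY))
    only-s-shared X∩Y X⊆W Y⊆W yX⊆yA yY⊆yA yX∩yY (inj₂ a) (inj₂ b) = ⊥-elim (yX∩yY a b)

    extendable-S : Extendable S
    extendable-S =
      extendable-++ PI (PC ++ PD) s (extendable split-I)
        (extendable-++ PC PD s (extendable split-C) (extendable split-D) shared-C-D) shared-I-CD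
      where
      shared-C-D : ∀ z → z ∈ varsS PC → z ∈ varsS PD → z ≡ s
      shared-C-D z a b = only-s-shared C∖I-∉D∖I W-C' W-D' yC⊆yA yD⊆yA yC∉yD
        (support split-C C''↭C' a) (support split-D D''↭D' b)
      shared-I-CD : ∀ z → z ∈ varsS PI → z ∈ varsS (PC ++ PD) → z ≡ s
      shared-I-CD z a b with varsS-++⁻ PC PD b
      ... | inj₁ c = only-s-shared (λ m m' → C∖I-∉I m' m) W-I' W-C' yI⊆yA yC⊆yA yI∉yC
        (support split-I I''↭I' a) (support split-C C''↭C' c)
      ... | inj₂ d = only-s-shared (λ m m' → D∖I-∉I m' m) W-I' W-D' yI⊆yA yD⊆yA yI∉yD
        (support split-I I''↭I' a) (support split-D D''↭D' d)

    distinct-S : All (λ E → Unique (vars E)) S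
    distinct-S = ++⁺ (distinct-clauses split-I) (++⁺ (distinct-clauses split-C) (distinct-clauses split-D))

    models-parts : ∀ {ψ} → All (XSat ψ) S → All (XSat ψ) PI × All (XSat ψ) PC × All (XSat ψ) PD
    models-parts a = ++⁻ˡ PI a , ++⁻ˡ PC (++⁻ʳ PI a) , ++⁻ʳ PC (++⁻ʳ PI a)

    sound-S : ∀ ψ → All (XSat ψ) S → XSatS ψ (C ∷ D ∷ [])
    sound-S ψ models with models-parts models
    ... | mI , mC , mD = Equivalence.from (represents ψ) (ψ , (λ _ _ → refl) ,
          XSat-↭ I''↭I' (sound split-I mI) ∷ XSat-↭ C''↭C' (sound split-C mC) ∷ XSat-↭ D''↭D' (sound split-D mD) ∷ [])

    s-value : ∀ {ψ} → All (XSat ψ) PI → ψ s ≡ xorVal ψ I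
    s-value {ψ} models = xor-false _ _ (trans (sym (xorVal-+s ψ I s)) (XSat-↭ I''↭I' (sound split-I models)))

    determined-S : ∀ {ψ₁ ψ₂} → All (XSat ψ₁) S → All (XSat ψ₂) S →
      (∀ v → v ∈ V → ψ₁ v ≡ ψ₂ v) → ∀ z → z ∈ varsS S → ψ₁ z ≡ ψ₂ z
    determined-S {ψ₁} {ψ₂} models₁ models₂ agree z m with models-parts models₁ | models-parts models₂
    ... | mI₁ , mC₁ , mD₁ | mI₂ , mC₂ , mD₂ = by-piece (varsS-++⁻ PI (PC ++ PD) m)
      where
      agree-s : ψ₁ s ≡ ψ₂ s
      agree-s = trans (s-value mI₁)
        (trans (xorVal-cong I (λ w m → agree w (V-C (vars-partˡ I C∖I C-split m)))) (sym (s-value mI₂)))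
      agree-clause : ∀ {K} X → K ↭ X +s → (∀ {w} → w ∈ vars X → w ∈ V) → ∀ w → w ∈ vars K → ψ₁ w ≡ ψ₂ w
      agree-clause X K↭X+s X⊆V w m with vars-+s⁻ X (vars-↭ K↭X+s m)
      ... | inj₁ a = agree w (X⊆V a)
      ... | inj₂ refl = agree-s
      by-piece : z ∈ varsS PI ⊎ z ∈ varsS (PC ++ PD) → ψ₁ z ≡ ψ₂ z
      by-piece (inj₁ a) =
        determined split-I mI₁ mI₂ (agree-clause I I''↭I' (λ m → V-C (vars-partˡ I C∖I C-split m))) z a
      by-piece (inj₂ b) with varsS-++⁻ PC PD b
      ... | inj₁ c = determined split-C mC₁ mC₂ (agree-clause C∖I C''↭C' (λ m → V-C (vars-partʳ I C∖I C-split m))) z c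
      ... | inj₂ d = determined split-D mD₁ mD₂ (agree-clause D∖I D''↭D' (λ m → V-D (vars-partʳ I D∖I D-split m))) z d

    W∌yA : ∀ {z} → z ∈ W → z ∉ yA
    W∌yA m m' = fresh _ m' m

    V⊆W : ∀ {z} → z ∈ V → z ∈ W
    V⊆W m with V-parts m
    ... | inj₁ a = W-I' (vars-+s⁺ I a)
    ... | inj₂ (inj₁ b) = W-C' (vars-+s⁺ C∖I b)
    ... | inj₂ (inj₂ c) = W-D' (vars-+s⁺ D∖I c)

    piece-avoids : ∀ {K X} {yX yY : List Var} → Splitting K yX → K ↭ X +s →
      (∀ {w} → w ∈ vars (X +s) → w ∈ W) → (∀ {w} → w ∈ yY → w ∈ yA) → (∀ {w} → w ∈ yX → w ∉ yY) →
      ∀ {z} → z ∈ varsS (natSplit K yX) → z ∉ yY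
    piece-avoids sp K↭X+s X+s⊆W yY⊆yA yX∩yY m with support sp K↭X+s m
    ... | inj₁ a = λ b → W∌yA (X+s⊆W a) (yY⊆yA b)
    ... | inj₂ a = yX∩yY a

    C''⊆W : ∀ {z} → z ∈ vars C'' → z ∈ W
    C''⊆W m = W-C' (vars-↭ C''↭C' m)
    D''⊆W : ∀ {z} → z ∈ vars D'' → z ∈ W
    D''⊆W m = W-D' (vars-↭ D''↭D' m)

    keep-clause : ∀ {ψ ψ' K} {ys : List Var} → (∀ z → z ∉ ys → ψ' z ≡ ψ z) →
      (∀ {z} → z ∈ vars K → z ∈ W) → (∀ {w} → w ∈ ys → w ∈ yA) → XSat ψ K → XSat ψ' K
    keep-clause {K = K} same K⊆W ys⊆yA e = trans (xorVal-cong K (λ z m → same z (λ m' → W∌yA (K⊆W m) (ys⊆yA m')))) e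

    -- the pieces are completed one after the other, each changing only its new variables
    complete-S : ∀ ψ → XSatS ψ (C ∷ D ∷ []) → ∃ λ ψ' → (∀ v → v ∈ V → ψ' v ≡ ψ v) × All (XSat ψ') S
    complete-S ψ sat with Equivalence.to (represents ψ) sat
    ... | ψ₁ , agree₁ , (sat-I' ∷ sat-C' ∷ sat-D' ∷ [])
      with complete split-I (XSat-↭ (↭-sym I''↭I') sat-I')
    ... | ψa , same-a , mI
      with complete split-C (keep-clause same-a C''⊆W yI⊆yA (XSat-↭ (↭-sym C''↭C') sat-C'))
    ... | ψb , same-b , mC
      with complete split-D (keep-clause same-b D''⊆W yC⊆yA (keep-clause same-a D''⊆W yI⊆yA (XSat-↭ (↭-sym D''↭D') sat-D')))
    ... | ψc , same-c , mD = ψc , agree , ++⁺ mI' (++⁺ mC' mD)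
      where
      agree : ∀ v → v ∈ V → ψc v ≡ ψ v
      agree v m = trans (same-c v (λ b → W∌yA (V⊆W m) (yD⊆yA b)))
        (trans (same-b v (λ b → W∌yA (V⊆W m) (yC⊆yA b)))
          (trans (same-a v (λ b → W∌yA (V⊆W m) (yI⊆yA b))) (agree₁ v m)))
      mC' : All (XSat ψc) PC
      mC' = models-cong PC (λ z m → same-c z (piece-avoids split-C C''↭C' W-C' yD⊆yA yC∉yD m)) mC
      mI' : All (XSat ψc) PI
      mI' = models-cong PI (λ z m → trans (same-c z (piece-avoids split-I I''↭I' W-I' yD⊆yA yI∉yD m))
                                          (same-b z (piece-avoids split-I I''↭I' W-I' yC⊆yA yI∉yC m))) mI

    in-I : ∀ {z} → z ∈ vars I → z ∈ varsS S
    in-I a = varsS-++ˡ PI (PC ++ PD) (covers split-I _ (vars-↭ (↭-sym I''↭I') (vars-+s⁺ I a)))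
    in-C∖I : ∀ {z} → z ∈ vars C∖I → z ∈ varsS S
    in-C∖I b = varsS-++ʳ PI (PC ++ PD) (varsS-++ˡ PC PD (covers split-C _ (vars-↭ (↭-sym C''↭C') (vars-+s⁺ C∖I b))))
    in-D∖I : ∀ {z} → z ∈ vars D∖I → z ∈ varsS S
    in-D∖I b = varsS-++ʳ PI (PC ++ PD) (varsS-++ʳ PC PD (covers split-D _ (vars-↭ (↭-sym D''↭D') (vars-+s⁺ D∖I b))))

    V⊆S : ∀ {z} → z ∈ V → z ∈ varsS S
    V⊆S m with V-parts m
    ... | inj₁ a = in-I a
    ... | inj₂ (inj₁ b) = in-C∖I b
    ... | inj₂ (inj₂ c) = in-D∖I c

    X₂≡X₀S : X₁C I'' yI ++ X₁C C'' yC ++ X₁C D'' yD ≡ concatMap X₀ S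
    X₂≡X₀S = sym (trans (concatMap-++ X₀ PI (PC ++ PD)) (cong (concatMap X₀ PI ++_) (concatMap-++ X₀ PC PD)))

    absolute-forcing : AbsForcingRep (C ∷ D ∷ []) (X₁C I'' yI ++ X₁C C'' yC ++ X₁C D'' yD)
    absolute-forcing = subst (AbsForcingRep (C ∷ D ∷ [])) (sym X₂≡X₀S)
      (AbsoluteForcing.absolute-forcing (C ∷ D ∷ []) S distinct-S extendable-S
        (λ v m → V⊆S m) sound-S complete-S determined-S)

theorem13p1 : (C D : XClause) → IsClause C → IsClause D →
    (∀ v → v ∈ vars C → v ∈ vars D → v ∈ vars (C ∩L D)) →
    2 ≤ length (C ∩L D) →
    length (C ∩L D) < length C →
    length (C ∩L D) < length D →
    (s : Var) → s ∉ vars C → s ∉ vars D →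
    let I = C ∩L D
        I' = I ++ (pos s ∷ [])
        C' = (C ∖L I) ++ (pos s ∷ [])
        D' = (D ∖L I) ++ (pos s ∷ [])
    in
    Represents (I' ∷ C' ∷ D' ∷ []) (C ∷ D ∷ [])
    ×
    ((I'' C'' D'' : XClause) → I'' ↭ I' → C'' ↭ C' → D'' ↭ D' →
     (yI yC yD : List Var) →
     length yI ≡ length I' ∸ 2 → length yC ≡ length C' ∸ 2 → length yD ≡ length D' ∸ 2 →
     Unique (yI ++ yC ++ yD) →
     (∀ y → y ∈ yI ++ yC ++ yD → y ∉ varsS (I' ∷ C' ∷ D' ∷ [])) →
     AbsForcingRep (C ∷ D ∷ []) (X₁C I'' yI ++ X₁C C'' yC ++ X₁C D'' yD))
theorem13p1 C D distinct-C distinct-D shared |I|≥2 |I|<|C| |I|<|D| s s∉C s∉D =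
  TwoClauses.Linked.represents C D distinct-C distinct-D shared s s∉C s∉D ,
  λ I'' C'' D'' I''↭I' C''↭C' D''↭D' yI yC yD |yI| |yC| |yD| distinct-y fresh →
    X₂.Assembly.absolute-forcing C D distinct-C distinct-D shared |I|≥2 |I|<|C| |I|<|D| s s∉C s∉D
      I'' C'' D'' I''↭I' C''↭C' D''↭D' yI yC yD |yI| |yC| |yD| distinct-y fresh
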